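{- For integers $n,\ell,c\ge 0$ let $K_{n,\ell,c}$ denote the number of color-preserving flip-equivalence classes of 2-colored binary trees with $n$ nodes, exactly $c$ of which are colored $1$, and with exactly $\ell$ nodes having non-equivalent child subtrees (as defined in the context). Let $S(x,y,z)=\sum_{n\ge 0}\sum_{\ell\ge 0}\sum_{c\ge 0}K_{n,\ell,c}\,x^n y^\ell z^c$, a formal power series in $x,y,z$. Then $$S(x,y,z)=1+\frac{x(1+z)}{2}\Bigl[(2-y)\,S(x^2,y^2,z^2)+y\,S(x,y,z)^2\Bigr].$$
   Context: A binary tree is either the empty tree or consists of a root node together with an ordered pair (left subtree, right subtree) of binary trees (either of which may be empty). A 2-colored binary tree is a binary tree each of whose nodes is assigned a color in $\{0,1\}$. Two 2-colored binary trees are (color-preserving flip-)equivalent if both are empty, or both are nonempty, their roots have the same color, and either (left of first $\sim$ left of second and right of first $\sim$ right of second) or (left of first $\sim$ right of second and right of first $\sim$ left of second); equivalently, one is obtained from the other by swapping the children of any set of nodes, colors carried along. For a node $v$, its two child subtrees (possibly empty) are the subtrees rooted at its left and right children; $v$ has non-equivalent child subtrees if these two 2-colored subtrees are not equivalent (a node with exactly one nonempty child always qualifies; a leaf never does). The number of nodes, the number of nodes of color $1$, and the number of nodes with non-equivalent child subtrees are all invariant under this equivalence, so they are well defined for an equivalence class. -}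

module Defs where

open import Data.Nat as ℕ using (ℕ; zero; suc)
open import Data.Bool using (Bool; true; false)
open import Data.Maybe using (Maybe; just; nothing)
import Data.Maybe as Maybe
open import Data.Unit using (⊤)
open import Data.Empty using (⊥)
open import Data.Product using (_×_; Σ-syntax; ∃-syntax)
open import Data.Sum using (_⊎_)
open import Data.List using (List; length)
open import Data.List.Relation.Unary.All using (All)
open import Data.List.Relation.Unary.Any using (Any)
open import Data.List.Relation.Unary.AllPairs using (AllPairs)
open import Data.Integer using (+_)
open import Data.Rational using (ℚ; 0ℚ; 1ℚ; _/_)
import Data.Rational as Q
open import Relation.Nullary using (¬_)
open import Relation.Binary.PropositionalEquality using (_≡_)

-- 2-colored binary trees (colors 0,1 encoded as false,true)

data Tree : Set where
  empty : Tree
  node  : Bool → Tree → Tree → Tree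

_∼_ : Tree → Tree → Set
empty ∼ empty = ⊤
empty ∼ node _ _ _ = ⊥
node _ _ _ ∼ empty = ⊥
node a l r ∼ node b l′ r′ = a ≡ b × ((l ∼ l′ × r ∼ r′) ⊎ (l ∼ r′ × r ∼ l′))

colorVal : Bool → ℕ
colorVal false = 0
colorVal true  = 1

data Stats : Tree → ℕ → ℕ → ℕ → Set where
  st-empty : Stats empty 0 0 0
  st-eq    : ∀ {col a b n₁ ℓ₁ c₁ n₂ ℓ₂ c₂} →
             Stats a n₁ ℓ₁ c₁ → Stats b n₂ ℓ₂ c₂ → a ∼ b →
             Stats (node col a b) (suc (n₁ ℕ.+ n₂)) (ℓ₁ ℕ.+ ℓ₂) (colorVal col ℕ.+ (c₁ ℕ.+ c₂))
  st-neq   : ∀ {col a b n₁ ℓ₁ c₁ n₂ ℓ₂ c₂} →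
             Stats a n₁ ℓ₁ c₁ → Stats b n₂ ℓ₂ c₂ → ¬ (a ∼ b) →
             Stats (node col a b) (suc (n₁ ℕ.+ n₂)) (suc (ℓ₁ ℕ.+ ℓ₂)) (colorVal col ℕ.+ (c₁ ℕ.+ c₂))

NumClasses : ℕ → ℕ → ℕ → ℕ → Set
NumClasses n ℓ c k =
  ∃[ reps ] (length reps ≡ k
            × All (λ t → Stats t n ℓ c) reps
            × AllPairs (λ s t → ¬ (s ∼ t)) reps
            × (∀ t → Stats t n ℓ c → Any (λ r → t ∼ r) reps))

-- Formal power series in x, y, z with rational coefficients:
-- f n ℓ c is the coefficient of x^n y^ℓ z^c.

PS : Set
PS = ℕ → ℕ → ℕ → ℚ

sumTo : (ℕ → ℚ) → ℕ → ℚ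
sumTo f zero    = f zero
sumTo f (suc n) = sumTo f n Q.+ f (suc n)

infixl 6 _⊕_ _⊖_
infixl 7 _⊗_ _⊙_

_⊕_ : PS → PS → PS
(f ⊕ g) n ℓ c = f n ℓ c Q.+ g n ℓ c

_⊖_ : PS → PS → PS
(f ⊖ g) n ℓ c = f n ℓ c Q.- g n ℓ c

_⊗_ : PS → PS → PS
(f ⊗ g) n ℓ c =
  sumTo (λ i → sumTo (λ j → sumTo (λ k →
    f i j k Q.* g (n ℕ.∸ i) (ℓ ℕ.∸ j) (c ℕ.∸ k)) c) ℓ) n

_⊙_ : ℚ → PS → PS
(q ⊙ f) n ℓ c = q Q.* f n ℓ c

mono : ℕ → ℕ → ℕ → PS
mono a b d n ℓ c with a ℕ.≟ n | b ℕ.≟ ℓ | d ℕ.≟ c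
... | Relation.Nullary.yes _ | Relation.Nullary.yes _ | Relation.Nullary.yes _ = 1ℚ
... | _ | _ | _ = 0ℚ

one X Y Z : PS
one = mono 0 0 0
X = mono 1 0 0
Y = mono 0 1 0
Z = mono 0 0 1

halve : ℕ → Maybe ℕ
halve zero          = just zero
halve (suc zero)    = nothing
halve (suc (suc n)) = Maybe.map suc (halve n)

squareVars : PS → PS
squareVars f n ℓ c with halve n | halve ℓ | halve c
... | just n′ | just ℓ′ | just c′ = f n′ ℓ′ c′
... | _ | _ | _ = 0ℚ

genSeries : (ℕ → ℕ → ℕ → ℕ) → PS
genSeries K n ℓ c = + (K n ℓ c) / 1

-- Let classes m list one representative of each flip-equivalence class of trees with at most
-- m nodes. A class with m + 1 nodes is a root colour together with an unordered pair {a, b} of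
-- classes with |a| + |b| = m, so S = 1 + x (1 + z) F, where F (forks) weighs such a pair by
-- x^(|a| + |b|) y^([a ≁ b] + asym a + asym b) z^(ones a + ones b). The pairs {a, a} contribute
-- S(x², y², z²) and the pairs with a ≁ b contribute y U, where S² = S(x², y², z²) + 2 U;
-- hence 2 F = (2 - y) S(x², y², z²) + y S². The counting is done with natural-number
-- coefficients and transported to rational coefficients by ι : ℕ → ℚ, which commutes with
-- sums and products.

module Submission where

open import Defs
open import Data.Bool using (true; false; if_then_else_)
import Data.Bool as Bool
open import Data.Unit using (tt)
open import Data.Nat using (ℕ; zero; suc; _+_; _*_; _∸_; _≤_; _<_; z≤n; s≤s; _≟_; _≤?_)
import Data.Nat.Properties as ℕP
open import Data.List using (List; []; _∷_; _++_; map; length; filter)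
open import Data.List.Relation.Unary.All as All using (All; []; _∷_)
open import Data.Product using (Σ-syntax; _×_; _,_; proj₁; proj₂; uncurry)
open import Data.Sum using (_⊎_; inj₁; inj₂)
open import Data.Maybe using (just; nothing; maybe′)
import Data.Maybe.Properties as Maybe
open import Data.List.Relation.Unary.AllPairs as AllPairs using (AllPairs; []; _∷_)
import Data.List.Relation.Unary.All.Properties as AllP
open import Data.List.Relation.Unary.Any as Any using (Any; here; there)
import Data.List.Relation.Unary.Any.Properties as AnyP
import Data.List.Relation.Unary.AllPairs.Properties as APP
import Data.Sum as Sum
open import Function using (_∘_; case_of_)
open import Level using (0ℓ)
open import Relation.Binary.Bundles using (Setoid)
open import Relation.Nullary.Negation using (contradiction)
open import Relation.Nullary using (¬_; Dec; does; yes; no)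
open import Relation.Nullary.Decidable using (dec-true; dec-false; _×-dec_; _⊎-dec_; ¬?)
open import Relation.Unary using (Decidable)
open import Relation.Binary.PropositionalEquality
open import Relation.Binary.Definitions using (tri<; tri≈; tri>)
open import Data.Nat.Tactic.RingSolver using (solve-∀)
import Data.Nat.Coprimality as Coprime
import Data.Integer as ℤ
import Data.Integer.Properties as ℤP
open import Data.Rational as Q using (ℚ; mkℚ; ½; _/_)
import Data.Rational.Properties as ℚP
open import Data.Rational.Solver using (module +-*-Solver)
open +-*-Solver using (solve; _:+_; _:*_; _:-_; _:=_; con)
open import Algebra.Properties.CommutativeSemigroup ℕP.+-commutativeSemigroup using () renaming (interchange to +-interchange)

open ≡-Reasoning

private
  variable
    A B : Set
    P P′ : Set

-- Indicators and finite sums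

𝟙 : Dec P → ℕ
𝟙 p? = if does p? then 1 else 0

𝟙-yes : (p? : Dec P) → P → 𝟙 p? ≡ 1
𝟙-yes p? p rewrite dec-true p? p = refl

𝟙-no : (p? : Dec P) → ¬ P → 𝟙 p? ≡ 0
𝟙-no p? ¬p rewrite dec-false p? ¬p = refl

𝟙-cong : (p? : Dec P) (q? : Dec P′) → (P → P′) → (P′ → P) → 𝟙 p? ≡ 𝟙 q?
𝟙-cong (yes p) q? f g = sym (𝟙-yes q? (f p))
𝟙-cong (no ¬p) q? f g = sym (𝟙-no q? (λ q → ¬p (g q)))

𝟙-×-dec : (p? : Dec P) (q? : Dec P′) → 𝟙 (p? ×-dec q?) ≡ 𝟙 p? * 𝟙 q?
𝟙-×-dec (yes _) q? = sym (ℕP.*-identityˡ (𝟙 q?))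
𝟙-×-dec (no _)  q? = refl

δ : ℕ → ℕ → ℕ
δ m n = 𝟙 (m ≟ n)

δ-refl : ∀ n → δ n n ≡ 1
δ-refl n = 𝟙-yes (n ≟ n) refl

∑ : List A → (A → ℕ) → ℕ
∑ []       f = 0
∑ (x ∷ xs) f = f x + ∑ xs f

syntax ∑ xs (λ x → e) = ∑[ x ∈ xs ] e

∑-++ : ∀ xs ys (f : A → ℕ) → ∑ (xs ++ ys) f ≡ ∑ xs f + ∑ ys f
∑-++ []       ys f = refl
∑-++ (x ∷ xs) ys f = trans (cong (f x +_) (∑-++ xs ys f)) (sym (ℕP.+-assoc (f x) _ _))

∑-map : ∀ (g : A → B) xs (f : B → ℕ) → ∑ (map g xs) f ≡ ∑[ x ∈ xs ] f (g x)
∑-map g []       f = refl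
∑-map g (x ∷ xs) f = cong (f (g x) +_) (∑-map g xs f)

∑-cong-All : ∀ {xs} {f g : A → ℕ} → All (λ x → f x ≡ g x) xs → ∑ xs f ≡ ∑ xs g
∑-cong-All []         = refl
∑-cong-All (fx≡gx ∷ eqs) = cong₂ _+_ fx≡gx (∑-cong-All eqs)

∑-cong : ∀ xs {f g : A → ℕ} → (∀ x → f x ≡ g x) → ∑ xs f ≡ ∑ xs g
∑-cong xs f≗g = ∑-cong-All (All.universal f≗g xs)

∑-zero : ∀ {xs} {f : A → ℕ} → All (λ x → f x ≡ 0) xs → ∑ xs f ≡ 0
∑-zero []           = refl
∑-zero (fx≡0 ∷ eqs) = cong₂ _+_ fx≡0 (∑-zero eqs)

∑-+ : ∀ xs (f g : A → ℕ) → ∑[ x ∈ xs ] (f x + g x) ≡ ∑ xs f + ∑ xs g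
∑-+ []       f g = refl
∑-+ (x ∷ xs) f g = trans (cong (f x + g x +_) (∑-+ xs f g))
  (+-interchange (f x) (g x) (∑ xs f) (∑ xs g))

∑-*ˡ : ∀ xs a (f : A → ℕ) → ∑[ x ∈ xs ] (a * f x) ≡ a * ∑ xs f
∑-*ˡ []       a f = sym (ℕP.*-zeroʳ a)
∑-*ˡ (x ∷ xs) a f = trans (cong (a * f x +_) (∑-*ˡ xs a f)) (sym (ℕP.*-distribˡ-+ a (f x) _))

∑-*ʳ : ∀ xs a (f : A → ℕ) → ∑[ x ∈ xs ] (f x * a) ≡ ∑ xs f * a
∑-*ʳ xs a f = trans (∑-cong xs (λ x → ℕP.*-comm (f x) a)) (trans (∑-*ˡ xs a f) (ℕP.*-comm a _))

module _ {P : A → Set} (P? : Decidable P) where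

  ∑-filter : ∀ xs (f : A → ℕ) → (∀ x → ¬ P x → f x ≡ 0) → ∑ (filter P? xs) f ≡ ∑ xs f
  ∑-filter []       f f≡0 = refl
  ∑-filter (x ∷ xs) f f≡0 with P? x
  ... | yes _  = cong (f x +_) (∑-filter xs f f≡0)
  ... | no ¬px = trans (∑-filter xs f f≡0) (cong (_+ ∑ xs f) (sym (f≡0 x ¬px)))

  length-filter : ∀ xs → length (filter P? xs) ≡ ∑[ x ∈ xs ] 𝟙 (P? x)
  length-filter []       = refl
  length-filter (x ∷ xs) with P? x
  ... | yes _ = cong suc (length-filter xs)
  ... | no _  = length-filter xs

Any-filter⁺ : ∀ {P Q : A → Set} (Q? : Decidable Q) {xs} → Any (λ x → P x × Q x) xs → Any P (filter Q? xs)
Any-filter⁺ Q? p = Sum.[ Any.map proj₁ , (λ ¬q → contradiction (proj₂ (AnyP.lookup-result p)) ¬q) ]′ (AnyP.filter⁺ Q? p)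

∑≤ : ℕ → (ℕ → ℕ) → ℕ
∑≤ zero    f = f zero
∑≤ (suc n) f = ∑≤ n f + f (suc n)

syntax ∑≤ n (λ i → e) = ∑[ i ≤ n ] e

∑≤-cong : ∀ n {f g : ℕ → ℕ} → (∀ i → i ≤ n → f i ≡ g i) → ∑≤ n f ≡ ∑≤ n g
∑≤-cong zero    f≗g = f≗g 0 z≤n
∑≤-cong (suc n) f≗g = cong₂ _+_ (∑≤-cong n (λ i i≤n → f≗g i (ℕP.m≤n⇒m≤1+n i≤n))) (f≗g (suc n) ℕP.≤-refl)

∑≤-*ˡ : ∀ n a (f : ℕ → ℕ) → ∑[ i ≤ n ] (a * f i) ≡ a * ∑≤ n f
∑≤-*ˡ zero    a f = refl
∑≤-*ˡ (suc n) a f = trans (cong (_+ a * f (suc n)) (∑≤-*ˡ n a f)) (sym (ℕP.*-distribˡ-+ a _ (f (suc n))))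

∑≤-∑ : ∀ n xs (F : ℕ → A → ℕ) → ∑[ i ≤ n ] ∑[ x ∈ xs ] F i x ≡ ∑[ x ∈ xs ] ∑[ i ≤ n ] F i x
∑≤-∑ zero    xs F = refl
∑≤-∑ (suc n) xs F = trans (cong (_+ ∑ xs (F (suc n))) (∑≤-∑ n xs F)) (sym (∑-+ xs _ (F (suc n))))

∑≤³-∑ : ∀ n ℓ c xs (F : A → ℕ → ℕ → ℕ → ℕ) →
        ∑[ i ≤ n ] ∑[ j ≤ ℓ ] ∑[ k ≤ c ] ∑[ x ∈ xs ] F x i j k
      ≡ ∑[ x ∈ xs ] ∑[ i ≤ n ] ∑[ j ≤ ℓ ] ∑[ k ≤ c ] F x i j k
∑≤³-∑ n ℓ c xs F = begin
  ∑[ i ≤ n ] ∑[ j ≤ ℓ ] ∑[ k ≤ c ] ∑[ x ∈ xs ] F x i j k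
    ≡⟨ ∑≤-cong n (λ i _ → ∑≤-cong ℓ (λ j _ → ∑≤-∑ c xs (λ k x → F x i j k))) ⟩
  ∑[ i ≤ n ] ∑[ j ≤ ℓ ] ∑[ x ∈ xs ] ∑[ k ≤ c ] F x i j k
    ≡⟨ ∑≤-cong n (λ i _ → ∑≤-∑ ℓ xs (λ j x → ∑[ k ≤ c ] F x i j k)) ⟩
  ∑[ i ≤ n ] ∑[ x ∈ xs ] ∑[ j ≤ ℓ ] ∑[ k ≤ c ] F x i j k
    ≡⟨ ∑≤-∑ n xs (λ i x → ∑[ j ≤ ℓ ] ∑[ k ≤ c ] F x i j k) ⟩
  ∑[ x ∈ xs ] ∑[ i ≤ n ] ∑[ j ≤ ℓ ] ∑[ k ≤ c ] F x i j k ∎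

∑≤-δ : ∀ n a (f : ℕ → ℕ) → ∑[ i ≤ n ] (δ a i * f i) ≡ 𝟙 (a ≤? n) * f a
∑≤-δ zero    zero    f = refl
∑≤-δ zero    (suc a) f = refl
∑≤-δ (suc n) a       f with ℕP.<-cmp a (suc n)
... | tri< a<1+n _ _ = begin
  ∑≤ n (λ i → δ a i * f i) + δ a (suc n) * f (suc n)
    ≡⟨ cong₂ _+_ (∑≤-δ n a f) (cong (_* f (suc n)) (𝟙-no (a ≟ suc n) (ℕP.<⇒≢ a<1+n))) ⟩
  𝟙 (a ≤? n) * f a + 0
    ≡⟨ ℕP.+-identityʳ _ ⟩
  𝟙 (a ≤? n) * f a
    ≡⟨ cong (_* f a) (trans (𝟙-yes (a ≤? n) (ℕP.≤-pred a<1+n)) (sym (𝟙-yes (a ≤? suc n) (ℕP.<⇒≤ a<1+n)))) ⟩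
  𝟙 (a ≤? suc n) * f a ∎
... | tri≈ _ refl _ = begin
  ∑≤ n (λ i → δ a i * f i) + δ a a * f a
    ≡⟨ cong₂ _+_ (∑≤-δ n a f) (cong (_* f a) (δ-refl a)) ⟩
  𝟙 (a ≤? n) * f a + 1 * f a
    ≡⟨ cong₂ (λ p q → p * f a + q * f a) (𝟙-no (a ≤? n) (ℕP.n≮n n)) (sym (𝟙-yes (a ≤? a) ℕP.≤-refl)) ⟩
  𝟙 (a ≤? a) * f a ∎
... | tri> _ _ 1+n<a = begin
  ∑≤ n (λ i → δ a i * f i) + δ a (suc n) * f (suc n)
    ≡⟨ cong₂ _+_ (∑≤-δ n a f) (cong (_* f (suc n)) (𝟙-no (a ≟ suc n) (ℕP.>⇒≢ 1+n<a))) ⟩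
  𝟙 (a ≤? n) * f a + 0
    ≡⟨ ℕP.+-identityʳ _ ⟩
  𝟙 (a ≤? n) * f a
    ≡⟨ cong (_* f a) (trans (𝟙-no (a ≤? n) (ℕP.<⇒≱ (ℕP.<-trans (ℕP.n<1+n n) 1+n<a)))
                            (sym (𝟙-no (a ≤? suc n) (ℕP.<⇒≱ 1+n<a)))) ⟩
  𝟙 (a ≤? suc n) * f a ∎

𝟙≤*δ∸≡δ+ : ∀ a b n → 𝟙 (a ≤? n) * δ b (n ∸ a) ≡ δ (a + b) n
𝟙≤*δ∸≡δ+ a b n with a ≤? n
... | yes a≤n = begin
  𝟙 (a ≤? n) * δ b (n ∸ a)  ≡⟨ cong (_* δ b (n ∸ a)) (𝟙-yes (a ≤? n) a≤n) ⟩
  1 * δ b (n ∸ a)           ≡⟨ ℕP.*-identityˡ _ ⟩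
  δ b (n ∸ a)               ≡⟨ 𝟙-cong (b ≟ n ∸ a) (a + b ≟ n)
                                 (λ b≡n∸a → trans (cong (a +_) b≡n∸a) (ℕP.m+[n∸m]≡n a≤n))
                                 (λ a+b≡n → trans (sym (ℕP.m+n∸m≡n a b)) (cong (_∸ a) a+b≡n)) ⟩
  δ (a + b) n               ∎
... | no a≰n = begin
  𝟙 (a ≤? n) * δ b (n ∸ a)  ≡⟨ cong (_* δ b (n ∸ a)) (𝟙-no (a ≤? n) a≰n) ⟩
  0                         ≡⟨ 𝟙-no (a + b ≟ n) (λ a+b≡n → a≰n (subst (a ≤_) a+b≡n (ℕP.m≤m+n a b))) ⟨
  δ (a + b) n               ∎

halve-double : ∀ a → halve (a + a) ≡ just a
halve-double zero    = refl
halve-double (suc a) rewrite ℕP.+-suc a a | halve-double a = refl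

halve-just : ∀ n {h} → halve n ≡ just h → h + h ≡ n
halve-just zero          refl = refl
halve-just (suc zero)    ()
halve-just (suc (suc n)) eq with halve n in eq′
halve-just (suc (suc n)) refl | just h = cong suc (trans (ℕP.+-suc h h) (cong suc (halve-just n eq′)))

δ-double : ∀ a n → δ (a + a) n ≡ maybe′ (δ a) 0 (halve n)
δ-double a n with halve n in halve-n
... | just h  = 𝟙-cong (a + a ≟ n) (a ≟ h)
  (λ a+a≡n → Maybe.just-injective (trans (sym (halve-double a)) (trans (cong halve a+a≡n) halve-n)))
  (λ a≡h → trans (cong (λ b → b + b) a≡h) (halve-just n halve-n))
... | nothing = 𝟙-no (a + a ≟ n)
  (λ a+a≡n → case trans (sym (halve-double a)) (trans (cong halve a+a≡n) halve-n) of λ ())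

-- Power series with natural coefficients

ℕSeries : Set
ℕSeries = ℕ → ℕ → ℕ → ℕ

monoᴺ : ℕ → ℕ → ℕ → ℕSeries
monoᴺ a b d n ℓ c = δ a n * (δ b ℓ * δ d c)

same? : ∀ a b d n ℓ c → Dec (a ≡ n × b ≡ ℓ × d ≡ c)
same? a b d n ℓ c = (a ≟ n) ×-dec ((b ≟ ℓ) ×-dec (d ≟ c))

monoᴺ-𝟙 : ∀ a b d n ℓ c → monoᴺ a b d n ℓ c ≡ 𝟙 (same? a b d n ℓ c)
monoᴺ-𝟙 a b d n ℓ c =
  sym (trans (𝟙-×-dec (a ≟ n) ((b ≟ ℓ) ×-dec (d ≟ c))) (cong (δ a n *_) (𝟙-×-dec (b ≟ ℓ) (d ≟ c))))

infixl 7 _⊗ᴺ_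

_⊗ᴺ_ : ℕSeries → ℕSeries → ℕSeries
(f ⊗ᴺ g) n ℓ c = ∑[ i ≤ n ] ∑[ j ≤ ℓ ] ∑[ k ≤ c ] (f i j k * g (n ∸ i) (ℓ ∸ j) (c ∸ k))

⊗ᴺ-cong≤ : ∀ {f f′ g g′ : ℕSeries} n ℓ c →
           (∀ i j k → i ≤ n → f i j k ≡ f′ i j k) → (∀ i j k → i ≤ n → g i j k ≡ g′ i j k) →
           (f ⊗ᴺ g) n ℓ c ≡ (f′ ⊗ᴺ g′) n ℓ c
⊗ᴺ-cong≤ n ℓ c f≗f′ g≗g′ = ∑≤-cong n (λ i i≤n → ∑≤-cong ℓ (λ j _ → ∑≤-cong c (λ k _ →
  cong₂ _*_ (f≗f′ i j k i≤n) (g≗g′ (n ∸ i) (ℓ ∸ j) (c ∸ k) (ℕP.m∸n≤m n i)))))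

monoᴺ-⊗ᴺ : ∀ a b d (f : ℕSeries) n ℓ c →
  (monoᴺ a b d ⊗ᴺ f) n ℓ c ≡ 𝟙 (a ≤? n) * (𝟙 (b ≤? ℓ) * (𝟙 (d ≤? c) * f (n ∸ a) (ℓ ∸ b) (c ∸ d)))
monoᴺ-⊗ᴺ a b d f n ℓ c = begin
  ∑[ i ≤ n ] ∑[ j ≤ ℓ ] ∑[ k ≤ c ] (δ a i * (δ b j * δ d k) * f (n ∸ i) (ℓ ∸ j) (c ∸ k))
    ≡⟨ ∑≤-cong n (λ i _ → ∑≤-cong ℓ (λ j _ → sum-over-k i j)) ⟩
  ∑[ i ≤ n ] ∑[ j ≤ ℓ ] (δ a i * (δ b j * (𝟙 (d ≤? c) * f (n ∸ i) (ℓ ∸ j) (c ∸ d))))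
    ≡⟨ ∑≤-cong n (λ i _ → trans (∑≤-*ˡ ℓ (δ a i) _) (cong (δ a i *_) (∑≤-δ ℓ b _))) ⟩
  ∑[ i ≤ n ] (δ a i * (𝟙 (b ≤? ℓ) * (𝟙 (d ≤? c) * f (n ∸ i) (ℓ ∸ b) (c ∸ d))))
    ≡⟨ ∑≤-δ n a _ ⟩
  𝟙 (a ≤? n) * (𝟙 (b ≤? ℓ) * (𝟙 (d ≤? c) * f (n ∸ a) (ℓ ∸ b) (c ∸ d))) ∎
  where
  sum-over-k : ∀ i j → ∑[ k ≤ c ] (δ a i * (δ b j * δ d k) * f (n ∸ i) (ℓ ∸ j) (c ∸ k))
                     ≡ δ a i * (δ b j * (𝟙 (d ≤? c) * f (n ∸ i) (ℓ ∸ j) (c ∸ d)))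
  sum-over-k i j = begin
    ∑[ k ≤ c ] (δ a i * (δ b j * δ d k) * F k)   ≡⟨ ∑≤-cong c (λ k _ → reassoc (δ a i) (δ b j) (δ d k) (F k)) ⟩
    ∑[ k ≤ c ] (δ a i * δ b j * (δ d k * F k))   ≡⟨ ∑≤-*ˡ c (δ a i * δ b j) _ ⟩
    δ a i * δ b j * ∑[ k ≤ c ] (δ d k * F k)     ≡⟨ cong (δ a i * δ b j *_) (∑≤-δ c d F) ⟩
    δ a i * δ b j * (𝟙 (d ≤? c) * F d)           ≡⟨ ℕP.*-assoc (δ a i) (δ b j) _ ⟩
    δ a i * (δ b j * (𝟙 (d ≤? c) * F d))         ∎
    where
    F : ℕ → ℕ
    F k = f (n ∸ i) (ℓ ∸ j) (c ∸ k)
    reassoc : ∀ x y z w → x * (y * z) * w ≡ x * y * (z * w)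
    reassoc = solve-∀

monoᴺ-⊗ᴺ-in : ∀ a b d (f : ℕSeries) n ℓ c → a ≤ n → b ≤ ℓ → d ≤ c →
               (monoᴺ a b d ⊗ᴺ f) n ℓ c ≡ f (n ∸ a) (ℓ ∸ b) (c ∸ d)
monoᴺ-⊗ᴺ-in a b d f n ℓ c a≤n b≤ℓ d≤c = begin
  (monoᴺ a b d ⊗ᴺ f) n ℓ c
    ≡⟨ monoᴺ-⊗ᴺ a b d f n ℓ c ⟩
  𝟙 (a ≤? n) * (𝟙 (b ≤? ℓ) * (𝟙 (d ≤? c) * F))
    ≡⟨ cong₂ _*_ (𝟙-yes (a ≤? n) a≤n) (cong₂ _*_ (𝟙-yes (b ≤? ℓ) b≤ℓ) (cong (_* F) (𝟙-yes (d ≤? c) d≤c))) ⟩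
  1 * (1 * (1 * F))
    ≡⟨ units F ⟩
  F ∎
  where
  F = f (n ∸ a) (ℓ ∸ b) (c ∸ d)
  units : ∀ x → 1 * (1 * (1 * x)) ≡ x
  units = solve-∀

monoᴺ-⊗ᴺ-out : ∀ a b d (f : ℕSeries) n ℓ c → n < a ⊎ ℓ < b ⊎ c < d → (monoᴺ a b d ⊗ᴺ f) n ℓ c ≡ 0
monoᴺ-⊗ᴺ-out a b d f n ℓ c out = trans (monoᴺ-⊗ᴺ a b d f n ℓ c) (vanish out)
  where
  F = f (n ∸ a) (ℓ ∸ b) (c ∸ d)
  vanish : n < a ⊎ ℓ < b ⊎ c < d → 𝟙 (a ≤? n) * (𝟙 (b ≤? ℓ) * (𝟙 (d ≤? c) * F)) ≡ 0
  vanish (inj₁ n<a) = cong (_* (𝟙 (b ≤? ℓ) * (𝟙 (d ≤? c) * F))) (𝟙-no (a ≤? n) (ℕP.<⇒≱ n<a))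
  vanish (inj₂ (inj₁ ℓ<b)) = begin
    𝟙 (a ≤? n) * (𝟙 (b ≤? ℓ) * (𝟙 (d ≤? c) * F))
      ≡⟨ cong (λ z → 𝟙 (a ≤? n) * (z * (𝟙 (d ≤? c) * F))) (𝟙-no (b ≤? ℓ) (ℕP.<⇒≱ ℓ<b)) ⟩
    𝟙 (a ≤? n) * 0
      ≡⟨ ℕP.*-zeroʳ (𝟙 (a ≤? n)) ⟩
    0 ∎
  vanish (inj₂ (inj₂ c<d)) = begin
    𝟙 (a ≤? n) * (𝟙 (b ≤? ℓ) * (𝟙 (d ≤? c) * F))
      ≡⟨ cong (λ z → 𝟙 (a ≤? n) * (𝟙 (b ≤? ℓ) * (z * F))) (𝟙-no (d ≤? c) (ℕP.<⇒≱ c<d)) ⟩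
    𝟙 (a ≤? n) * (𝟙 (b ≤? ℓ) * 0)
      ≡⟨ cong (𝟙 (a ≤? n) *_) (ℕP.*-zeroʳ (𝟙 (b ≤? ℓ))) ⟩
    𝟙 (a ≤? n) * 0
      ≡⟨ ℕP.*-zeroʳ (𝟙 (a ≤? n)) ⟩
    0 ∎

monoᴺ-⊗ᴺ-cong : ∀ a b d (f g : ℕSeries) n ℓ c → f (n ∸ a) (ℓ ∸ b) (c ∸ d) ≡ g (n ∸ a) (ℓ ∸ b) (c ∸ d) →
                (monoᴺ a b d ⊗ᴺ f) n ℓ c ≡ (monoᴺ a b d ⊗ᴺ g) n ℓ c
monoᴺ-⊗ᴺ-cong a b d f g n ℓ c f≡g = begin
  (monoᴺ a b d ⊗ᴺ f) n ℓ c
    ≡⟨ monoᴺ-⊗ᴺ a b d f n ℓ c ⟩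
  𝟙 (a ≤? n) * (𝟙 (b ≤? ℓ) * (𝟙 (d ≤? c) * f (n ∸ a) (ℓ ∸ b) (c ∸ d)))
    ≡⟨ cong (λ z → 𝟙 (a ≤? n) * (𝟙 (b ≤? ℓ) * (𝟙 (d ≤? c) * z))) f≡g ⟩
  𝟙 (a ≤? n) * (𝟙 (b ≤? ℓ) * (𝟙 (d ≤? c) * g (n ∸ a) (ℓ ∸ b) (c ∸ d)))
    ≡⟨ monoᴺ-⊗ᴺ a b d g n ℓ c ⟨
  (monoᴺ a b d ⊗ᴺ g) n ℓ c ∎

monoᴺ-⊗ᴺ-+ : ∀ a b d (f g : ℕSeries) n ℓ c →
  (monoᴺ a b d ⊗ᴺ (λ i j k → f i j k + g i j k)) n ℓ c ≡ (monoᴺ a b d ⊗ᴺ f) n ℓ c + (monoᴺ a b d ⊗ᴺ g) n ℓ c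
monoᴺ-⊗ᴺ-+ a b d f g n ℓ c = begin
  (monoᴺ a b d ⊗ᴺ (λ i j k → f i j k + g i j k)) n ℓ c
    ≡⟨ monoᴺ-⊗ᴺ a b d (λ i j k → f i j k + g i j k) n ℓ c ⟩
  𝟙 (a ≤? n) * (𝟙 (b ≤? ℓ) * (𝟙 (d ≤? c) * (f (n ∸ a) (ℓ ∸ b) (c ∸ d) + g (n ∸ a) (ℓ ∸ b) (c ∸ d))))
    ≡⟨ distrib (𝟙 (a ≤? n)) (𝟙 (b ≤? ℓ)) (𝟙 (d ≤? c)) _ _ ⟩
  𝟙 (a ≤? n) * (𝟙 (b ≤? ℓ) * (𝟙 (d ≤? c) * f (n ∸ a) (ℓ ∸ b) (c ∸ d)))
    + 𝟙 (a ≤? n) * (𝟙 (b ≤? ℓ) * (𝟙 (d ≤? c) * g (n ∸ a) (ℓ ∸ b) (c ∸ d)))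
    ≡⟨ cong₂ _+_ (monoᴺ-⊗ᴺ a b d f n ℓ c) (monoᴺ-⊗ᴺ a b d g n ℓ c) ⟨
  (monoᴺ a b d ⊗ᴺ f) n ℓ c + (monoᴺ a b d ⊗ᴺ g) n ℓ c ∎
  where
  distrib : ∀ x y z u v → x * (y * (z * (u + v))) ≡ x * (y * (z * u)) + x * (y * (z * v))
  distrib = solve-∀

monoᴺ-⊗ᴺ-* : ∀ a b d e (f : ℕSeries) n ℓ c →
  (monoᴺ a b d ⊗ᴺ (λ i j k → e * f i j k)) n ℓ c ≡ e * (monoᴺ a b d ⊗ᴺ f) n ℓ c
monoᴺ-⊗ᴺ-* a b d e f n ℓ c = begin
  (monoᴺ a b d ⊗ᴺ (λ i j k → e * f i j k)) n ℓ c
    ≡⟨ monoᴺ-⊗ᴺ a b d (λ i j k → e * f i j k) n ℓ c ⟩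
  𝟙 (a ≤? n) * (𝟙 (b ≤? ℓ) * (𝟙 (d ≤? c) * (e * f (n ∸ a) (ℓ ∸ b) (c ∸ d))))
    ≡⟨ commute (𝟙 (a ≤? n)) (𝟙 (b ≤? ℓ)) (𝟙 (d ≤? c)) e _ ⟩
  e * (𝟙 (a ≤? n) * (𝟙 (b ≤? ℓ) * (𝟙 (d ≤? c) * f (n ∸ a) (ℓ ∸ b) (c ∸ d))))
    ≡⟨ cong (e *_) (monoᴺ-⊗ᴺ a b d f n ℓ c) ⟨
  e * (monoᴺ a b d ⊗ᴺ f) n ℓ c ∎
  where
  commute : ∀ x y z e u → x * (y * (z * (e * u))) ≡ e * (x * (y * (z * u)))
  commute = solve-∀

monoᴺ-⊗ᴺ-monoᴺ : ∀ a b d a′ b′ d′ n ℓ c →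
  (monoᴺ a b d ⊗ᴺ monoᴺ a′ b′ d′) n ℓ c ≡ monoᴺ (a + a′) (b + b′) (d + d′) n ℓ c
monoᴺ-⊗ᴺ-monoᴺ a b d a′ b′ d′ n ℓ c = begin
  (monoᴺ a b d ⊗ᴺ monoᴺ a′ b′ d′) n ℓ c
    ≡⟨ monoᴺ-⊗ᴺ a b d (monoᴺ a′ b′ d′) n ℓ c ⟩
  𝟙 (a ≤? n) * (𝟙 (b ≤? ℓ) * (𝟙 (d ≤? c) * (δ a′ (n ∸ a) * (δ b′ (ℓ ∸ b) * δ d′ (c ∸ d)))))
    ≡⟨ interchange (𝟙 (a ≤? n)) (𝟙 (b ≤? ℓ)) (𝟙 (d ≤? c)) (δ a′ (n ∸ a)) (δ b′ (ℓ ∸ b)) (δ d′ (c ∸ d)) ⟩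
  𝟙 (a ≤? n) * δ a′ (n ∸ a) * (𝟙 (b ≤? ℓ) * δ b′ (ℓ ∸ b) * (𝟙 (d ≤? c) * δ d′ (c ∸ d)))
    ≡⟨ cong₂ _*_ (𝟙≤*δ∸≡δ+ a a′ n) (cong₂ _*_ (𝟙≤*δ∸≡δ+ b b′ ℓ) (𝟙≤*δ∸≡δ+ d d′ c)) ⟩
  monoᴺ (a + a′) (b + b′) (d + d′) n ℓ c ∎
  where
  interchange : ∀ p q r x y z → p * (q * (r * (x * (y * z)))) ≡ p * x * (q * y * (r * z))
  interchange = solve-∀

∑-⊗ᴺ : ∀ xs (F : A → ℕSeries) g n ℓ c →
       ((λ i j k → ∑[ x ∈ xs ] F x i j k) ⊗ᴺ g) n ℓ c ≡ ∑[ x ∈ xs ] (F x ⊗ᴺ g) n ℓ c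
∑-⊗ᴺ xs F g n ℓ c = trans
  (∑≤-cong n (λ i _ → ∑≤-cong ℓ (λ j _ → ∑≤-cong c (λ k _ →
    sym (∑-*ʳ xs (g (n ∸ i) (ℓ ∸ j) (c ∸ k)) (λ x → F x i j k))))))
  (∑≤³-∑ n ℓ c xs (λ x i j k → F x i j k * g (n ∸ i) (ℓ ∸ j) (c ∸ k)))

⊗ᴺ-∑ : ∀ xs f (G : A → ℕSeries) n ℓ c →
       (f ⊗ᴺ (λ i j k → ∑[ x ∈ xs ] G x i j k)) n ℓ c ≡ ∑[ x ∈ xs ] (f ⊗ᴺ G x) n ℓ c
⊗ᴺ-∑ xs f G n ℓ c = trans
  (∑≤-cong n (λ i _ → ∑≤-cong ℓ (λ j _ → ∑≤-cong c (λ k _ →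
    sym (∑-*ˡ xs (f i j k) (λ x → G x (n ∸ i) (ℓ ∸ j) (c ∸ k)))))))
  (∑≤³-∑ n ℓ c xs (λ x i j k → f i j k * G x (n ∸ i) (ℓ ∸ j) (c ∸ k)))

squareVarsᴺ : ℕSeries → ℕSeries
squareVarsᴺ f n ℓ c with halve n | halve ℓ | halve c
... | just n′ | just ℓ′ | just c′ = f n′ ℓ′ c′
... | _       | _       | _       = 0

squareVarsᴺ-cong≤ : ∀ {f g : ℕSeries} n ℓ c → (∀ i j k → i ≤ n → f i j k ≡ g i j k) →
                    squareVarsᴺ f n ℓ c ≡ squareVarsᴺ g n ℓ c
squareVarsᴺ-cong≤ n ℓ c f≗g with halve n in hn | halve ℓ | halve c
... | just h  | just _  | just _  = f≗g h _ _ (subst (h ≤_) (halve-just n hn) (ℕP.m≤m+n h h))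
... | nothing | _       | _       = refl
... | just _  | nothing | _       = refl
... | just _  | just _  | nothing = refl

-- Unordered pairs

offDiagonal : List A → List (A × A)
offDiagonal []       = []
offDiagonal (x ∷ xs) = map (x ,_) xs ++ offDiagonal xs

pairs : List A → List (A × A)
pairs xs = map (λ x → x , x) xs ++ offDiagonal xs

∑-pairs : ∀ xs (g : A × A → ℕ) → ∑ (pairs xs) g ≡ ∑[ x ∈ xs ] g (x , x) + ∑ (offDiagonal xs) g
∑-pairs xs g = trans (∑-++ (map _ xs) (offDiagonal xs) g) (cong (_+ ∑ (offDiagonal xs) g) (∑-map _ xs g))

∑²-symmetric : ∀ xs (g : A × A → ℕ) → (∀ x y → g (x , y) ≡ g (y , x)) →
               ∑[ x ∈ xs ] ∑[ y ∈ xs ] g (x , y) ≡ ∑[ x ∈ xs ] g (x , x) + 2 * ∑ (offDiagonal xs) g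
∑²-symmetric []       g g-sym = refl
∑²-symmetric (x ∷ xs) g g-sym = begin
  (g (x , x) + Row) + ∑[ y ∈ xs ] (g (y , x) + ∑[ z ∈ xs ] g (y , z))
    ≡⟨ cong (g (x , x) + Row +_) (∑-+ xs _ _) ⟩
  (g (x , x) + Row) + (∑[ y ∈ xs ] g (y , x) + ∑[ y ∈ xs ] ∑[ z ∈ xs ] g (y , z))
    ≡⟨ cong₂ (λ s t → g (x , x) + Row + (s + t)) (∑-cong xs (λ y → g-sym y x)) (∑²-symmetric xs g g-sym) ⟩
  (g (x , x) + Row) + (Row + (Diag + 2 * Off))
    ≡⟨ regroup (g (x , x)) Row Diag Off ⟩
  (g (x , x) + Diag) + 2 * (Row + Off)
    ≡⟨ cong (λ r → g (x , x) + Diag + 2 * (r + Off)) (∑-map (x ,_) xs g) ⟨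
  (g (x , x) + Diag) + 2 * (∑ (map (x ,_) xs) g + Off)
    ≡⟨ cong (λ s → g (x , x) + Diag + 2 * s) (∑-++ (map (x ,_) xs) (offDiagonal xs) g) ⟨
  (g (x , x) + Diag) + 2 * ∑ (offDiagonal (x ∷ xs)) g ∎
  where
  regroup : ∀ a r d o → (a + r) + (r + (d + 2 * o)) ≡ (a + d) + 2 * (r + o)
  regroup = solve-∀
  Row  = ∑[ y ∈ xs ] g (x , y)
  Diag = ∑[ y ∈ xs ] g (y , y)
  Off  = ∑ (offDiagonal xs) g

offDiagonal⁺ : ∀ {R : A → A → Set} {xs} → AllPairs R xs → All (uncurry R) (offDiagonal xs)
offDiagonal⁺ []            = []
offDiagonal⁺ (Rx ∷ R-rest) = AllP.++⁺ (AllP.map⁺ Rx) (offDiagonal⁺ R-rest)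

All-offDiagonal : ∀ {P : A → Set} {xs} → All P xs → All (λ p → P (proj₁ p) × P (proj₂ p)) (offDiagonal xs)
All-offDiagonal []         = []
All-offDiagonal (px ∷ pxs) = AllP.++⁺ (AllP.map⁺ (All.map (px ,_) pxs)) (All-offDiagonal pxs)

module UnorderedPairs (S : Setoid 0ℓ 0ℓ) where

  open Setoid S using (_≈_) renaming (Carrier to E; sym to ≈-sym; trans to ≈-trans)

  infix 4 _≈ₚ_

  _≈ₚ_ : E × E → E × E → Set
  (x , y) ≈ₚ (x′ , y′) = (x ≈ x′ × y ≈ y′) ⊎ (x ≈ y′ × y ≈ x′)

  pairs-complete : ∀ {a b xs} → Any (a ≈_) xs → Any (b ≈_) xs → Any ((a , b) ≈ₚ_) (pairs xs)
  pairs-complete a∈ b∈ = Sum.[ AnyP.++⁺ˡ , AnyP.++⁺ʳ _ ]′ (split a∈ b∈)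
    where
    split : ∀ {a b xs} → Any (a ≈_) xs → Any (b ≈_) xs →
            Any ((a , b) ≈ₚ_) (map (λ x → x , x) xs) ⊎ Any ((a , b) ≈ₚ_) (offDiagonal xs)
    split (here a≈x) (here b≈x) = inj₁ (here (inj₁ (a≈x , b≈x)))
    split (here a≈x) (there b∈) = inj₂ (AnyP.++⁺ˡ (AnyP.map⁺ (Any.map (λ b≈y → inj₁ (a≈x , b≈y)) b∈)))
    split (there a∈) (here b≈x) = inj₂ (AnyP.++⁺ˡ (AnyP.map⁺ (Any.map (λ a≈y → inj₂ (a≈y , b≈x)) a∈)))
    split (there a∈) (there b∈) = Sum.map there (AnyP.++⁺ʳ _) (split a∈ b∈)

  Distinct : List E → Set
  Distinct = AllPairs (λ x y → ¬ x ≈ y)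

  offDiagonal-distinct : ∀ {xs} → Distinct xs → AllPairs (λ p q → ¬ p ≈ₚ q) (offDiagonal xs)
  offDiagonal-distinct []                       = []
  offDiagonal-distinct {x ∷ xs} (x≉xs ∷ distinct) =
    APP.++⁺ (APP.map⁺ (AllPairs.map same-first distinct)) (offDiagonal-distinct distinct)
            (AllP.map⁺ (All.universal (λ _ → All.map apart (All-offDiagonal x≉xs)) xs))
    where
    same-first : ∀ {y z} → ¬ y ≈ z → ¬ (x , y) ≈ₚ (x , z)
    same-first y≉z (inj₁ (_ , y≈z))   = y≉z y≈z
    same-first y≉z (inj₂ (x≈z , y≈x)) = y≉z (≈-trans y≈x x≈z)
    apart : ∀ {y p} → ¬ x ≈ proj₁ p × ¬ x ≈ proj₂ p → ¬ (x , y) ≈ₚ p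
    apart (x≉u , _) (inj₁ (x≈u , _)) = x≉u x≈u
    apart (_ , x≉v) (inj₂ (x≈v , _)) = x≉v x≈v

  pairs-distinct : ∀ {xs} → Distinct xs → AllPairs (λ p q → ¬ p ≈ₚ q) (pairs xs)
  pairs-distinct {xs} distinct =
    APP.++⁺ (APP.map⁺ (AllPairs.map (λ x≉y → x≉y ∘ on-diagonal) distinct)) (offDiagonal-distinct distinct)
            (AllP.map⁺ (All.universal (λ _ → All.map diagonal-apart (offDiagonal⁺ distinct)) xs))
    where
    on-diagonal : ∀ {x y} → (x , x) ≈ₚ (y , y) → x ≈ y
    on-diagonal (inj₁ (x≈y , _)) = x≈y
    on-diagonal (inj₂ (x≈y , _)) = x≈y
    diagonal-apart : ∀ {x p} → ¬ proj₁ p ≈ proj₂ p → ¬ (x , x) ≈ₚ p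
    diagonal-apart u≉v (inj₁ (x≈u , x≈v)) = u≉v (≈-trans (≈-sym x≈u) x≈v)
    diagonal-apart u≉v (inj₂ (x≈v , x≈u)) = u≉v (≈-trans (≈-sym x≈u) x≈v)

-- Flip equivalence and tree statistics

∼-refl : ∀ t → t ∼ t
∼-refl empty        = tt
∼-refl (node _ l r) = refl , inj₁ (∼-refl l , ∼-refl r)

∼-sym : ∀ {s t} → s ∼ t → t ∼ s
∼-sym {empty}      {empty}      _                      = tt
∼-sym {node _ _ _} {node _ _ _} (refl , inj₁ (p , q)) = refl , inj₁ (∼-sym p , ∼-sym q)
∼-sym {node _ _ _} {node _ _ _} (refl , inj₂ (p , q)) = refl , inj₂ (∼-sym q , ∼-sym p)

∼-trans : ∀ {s t u} → s ∼ t → t ∼ u → s ∼ u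
∼-trans {empty}      {empty}      {empty}      _ _ = tt
∼-trans {node _ _ _} {node _ _ _} {node _ _ _} (refl , inj₁ (p , q)) (refl , inj₁ (p′ , q′)) =
  refl , inj₁ (∼-trans p p′ , ∼-trans q q′)
∼-trans {node _ _ _} {node _ _ _} {node _ _ _} (refl , inj₁ (p , q)) (refl , inj₂ (p′ , q′)) =
  refl , inj₂ (∼-trans p p′ , ∼-trans q q′)
∼-trans {node _ _ _} {node _ _ _} {node _ _ _} (refl , inj₂ (p , q)) (refl , inj₁ (p′ , q′)) =
  refl , inj₂ (∼-trans p q′ , ∼-trans q p′)
∼-trans {node _ _ _} {node _ _ _} {node _ _ _} (refl , inj₂ (p , q)) (refl , inj₂ (p′ , q′)) =
  refl , inj₁ (∼-trans p q′ , ∼-trans q p′)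

∼-setoid : Setoid 0ℓ 0ℓ
∼-setoid = record
  { Carrier       = Tree
  ; _≈_           = _∼_
  ; isEquivalence = record { refl = ∼-refl _ ; sym = ∼-sym ; trans = ∼-trans }
  }

-- node a l r ∼ node b l′ r′ unfolds to a ≡ b × (l , r) ≈ₚ (l′ , r′).
open UnorderedPairs ∼-setoid

_∼?_ : (s t : Tree) → Dec (s ∼ t)
empty      ∼? empty        = yes tt
empty      ∼? node _ _ _   = no λ ()
node _ _ _ ∼? empty        = no λ ()
node a l r ∼? node b l′ r′ =
  (a Bool.≟ b) ×-dec (((l ∼? l′) ×-dec (r ∼? r′)) ⊎-dec ((l ∼? r′) ×-dec (r ∼? l′)))

_≁?_ : (s t : Tree) → Dec (¬ s ∼ t)
s ≁? t = ¬? (s ∼? t)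

size asymmetries ones : Tree → ℕ
size empty        = 0
size (node _ l r) = suc (size l + size r)
asymmetries empty        = 0
asymmetries (node _ l r) = 𝟙 (l ≁? r) + (asymmetries l + asymmetries r)
ones empty          = 0
ones (node col l r) = colorVal col + (ones l + ones r)

stats : ∀ t → Stats t (size t) (asymmetries t) (ones t)
stats empty = st-empty
stats (node _ l r) with l ∼? r
... | yes l∼r = st-eq (stats l) (stats r) l∼r
... | no  l≁r = st-neq (stats l) (stats r) l≁r

Stats⇒≡ : ∀ {t n ℓ c} → Stats t n ℓ c → size t ≡ n × asymmetries t ≡ ℓ × ones t ≡ c
Stats⇒≡ st-empty = refl , refl , refl
Stats⇒≡ (st-eq {a = l} {b = r} sl sr l∼r) with Stats⇒≡ sl | Stats⇒≡ sr
... | refl , refl , refl | refl , refl , refl =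
  refl , cong (_+ (asymmetries l + asymmetries r)) (𝟙-no (l ≁? r) (λ l≁r → l≁r l∼r)) , refl
Stats⇒≡ (st-neq {a = l} {b = r} sl sr l≁r) with Stats⇒≡ sl | Stats⇒≡ sr
... | refl , refl , refl | refl , refl , refl =
  refl , cong (_+ (asymmetries l + asymmetries r)) (𝟙-yes (l ≁? r) l≁r) , refl

size-cong : ∀ {s t} → s ∼ t → size s ≡ size t
size-cong {empty}      {empty}      _ = refl
size-cong {node _ _ _} {node _ l′ r′} (refl , inj₁ (p , q)) = cong suc (cong₂ _+_ (size-cong p) (size-cong q))
size-cong {node _ _ _} {node _ l′ r′} (refl , inj₂ (p , q)) =
  cong suc (trans (cong₂ _+_ (size-cong p) (size-cong q)) (ℕP.+-comm (size r′) (size l′)))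

ones-cong : ∀ {s t} → s ∼ t → ones s ≡ ones t
ones-cong {empty}      {empty}      _ = refl
ones-cong {node _ _ _} {node col l′ r′} (refl , inj₁ (p , q)) = cong (colorVal col +_) (cong₂ _+_ (ones-cong p) (ones-cong q))
ones-cong {node _ _ _} {node col l′ r′} (refl , inj₂ (p , q)) =
  cong (colorVal col +_) (trans (cong₂ _+_ (ones-cong p) (ones-cong q)) (ℕP.+-comm (ones r′) (ones l′)))

∼-resp-≈ₚ : ∀ {l r l′ r′} → (l , r) ≈ₚ (l′ , r′) → l ∼ r → l′ ∼ r′
∼-resp-≈ₚ (inj₁ (l∼l′ , r∼r′)) l∼r = ∼-trans (∼-sym l∼l′) (∼-trans l∼r r∼r′)
∼-resp-≈ₚ (inj₂ (l∼r′ , r∼l′)) l∼r = ∼-trans (∼-sym r∼l′) (∼-trans (∼-sym l∼r) l∼r′)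

≈ₚ-sym : ∀ {p q} → p ≈ₚ q → q ≈ₚ p
≈ₚ-sym (inj₁ (l∼l′ , r∼r′)) = inj₁ (∼-sym l∼l′ , ∼-sym r∼r′)
≈ₚ-sym (inj₂ (l∼r′ , r∼l′)) = inj₂ (∼-sym r∼l′ , ∼-sym l∼r′)

≁-bit-cong : ∀ {l r l′ r′} → (l , r) ≈ₚ (l′ , r′) → 𝟙 (l ≁? r) ≡ 𝟙 (l′ ≁? r′)
≁-bit-cong {l} {r} {l′} {r′} l,r≈ₚl′,r′ =
  𝟙-cong (l ≁? r) (l′ ≁? r′) (λ l≁r → l≁r ∘ ∼-resp-≈ₚ (≈ₚ-sym l,r≈ₚl′,r′))
                             (λ l′≁r′ → l′≁r′ ∘ ∼-resp-≈ₚ l,r≈ₚl′,r′)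

asymmetries-cong : ∀ {s t} → s ∼ t → asymmetries s ≡ asymmetries t
asymmetries-cong {empty}      {empty}         _ = refl
asymmetries-cong {node _ _ _} {node _ l′ r′} (refl , l,r≈ₚl′,r′@(inj₁ (p , q))) =
  cong₂ _+_ (≁-bit-cong l,r≈ₚl′,r′) (cong₂ _+_ (asymmetries-cong p) (asymmetries-cong q))
asymmetries-cong {node _ _ _} {node _ l′ r′} (refl , l,r≈ₚl′,r′@(inj₂ (p , q))) =
  cong₂ _+_ (≁-bit-cong l,r≈ₚl′,r′)
            (trans (cong₂ _+_ (asymmetries-cong p) (asymmetries-cong q)) (ℕP.+-comm (asymmetries r′) (asymmetries l′)))

-- Weights of trees and of pairs of trees

weight : Tree → ℕSeries
weight t = monoᴺ (size t) (asymmetries t) (ones t)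

weight-vanishes : ∀ t {n} ℓ c → size t ≢ n → weight t n ℓ c ≡ 0
weight-vanishes t {n} ℓ c t≢n = cong (_* (δ (asymmetries t) ℓ * δ (ones t) c)) (𝟙-no (size t ≟ n) t≢n)

treeSeries : List Tree → ℕSeries
treeSeries ts n ℓ c = ∑[ t ∈ ts ] weight t n ℓ c

jointWeight : Tree × Tree → ℕSeries
jointWeight (x , y) = monoᴺ (size x + size y) (asymmetries x + asymmetries y) (ones x + ones y)

jointWeight-comm : ∀ x y n ℓ c → jointWeight (x , y) n ℓ c ≡ jointWeight (y , x) n ℓ c
jointWeight-comm x y n ℓ c
  rewrite ℕP.+-comm (size x) (size y) | ℕP.+-comm (asymmetries x) (asymmetries y) | ℕP.+-comm (ones x) (ones y) = refl

treeSeries-square : ∀ ts n ℓ c → (treeSeries ts ⊗ᴺ treeSeries ts) n ℓ c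
                  ≡ ∑[ x ∈ ts ] jointWeight (x , x) n ℓ c + 2 * ∑[ p ∈ offDiagonal ts ] jointWeight p n ℓ c
treeSeries-square ts n ℓ c = begin
  (treeSeries ts ⊗ᴺ treeSeries ts) n ℓ c
    ≡⟨ ∑-⊗ᴺ ts weight (treeSeries ts) n ℓ c ⟩
  ∑[ x ∈ ts ] (weight x ⊗ᴺ treeSeries ts) n ℓ c
    ≡⟨ ∑-cong ts (λ x → ⊗ᴺ-∑ ts (weight x) weight n ℓ c) ⟩
  ∑[ x ∈ ts ] ∑[ y ∈ ts ] (weight x ⊗ᴺ weight y) n ℓ c
    ≡⟨ ∑-cong ts (λ x → ∑-cong ts (λ y →
         monoᴺ-⊗ᴺ-monoᴺ (size x) (asymmetries x) (ones x) (size y) (asymmetries y) (ones y) n ℓ c)) ⟩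
  ∑[ x ∈ ts ] ∑[ y ∈ ts ] jointWeight (x , y) n ℓ c
    ≡⟨ ∑²-symmetric ts (λ p → jointWeight p n ℓ c) (λ x y → jointWeight-comm x y n ℓ c) ⟩
  ∑[ x ∈ ts ] jointWeight (x , x) n ℓ c + 2 * ∑[ p ∈ offDiagonal ts ] jointWeight p n ℓ c ∎

squareVarsᴺ-treeSeries : ∀ ts n ℓ c → squareVarsᴺ (treeSeries ts) n ℓ c ≡ ∑[ x ∈ ts ] jointWeight (x , x) n ℓ c
squareVarsᴺ-treeSeries ts n ℓ c = trans by-halves (∑-cong ts (λ x → sym (cong₂ _*_ (δ-double (size x) n)
                                    (cong₂ _*_ (δ-double (asymmetries x) ℓ) (δ-double (ones x) c)))))
  where
  by-halves : squareVarsᴺ (treeSeries ts) n ℓ c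
            ≡ ∑[ x ∈ ts ] (maybe′ (δ (size x)) 0 (halve n)
                            * (maybe′ (δ (asymmetries x)) 0 (halve ℓ) * maybe′ (δ (ones x)) 0 (halve c)))
  by-halves with halve n | halve ℓ | halve c
  ... | just _  | just _  | just _  = refl
  ... | nothing | _       | _       = sym (∑-zero (All.universal (λ _ → refl) ts))
  ... | just h  | nothing | _       = sym (∑-zero (All.universal (λ x → ℕP.*-zeroʳ (δ (size x) h)) ts))
  ... | just h  | just h′ | nothing = sym (∑-zero (All.universal (λ x →
          trans (cong (δ (size x) h *_) (ℕP.*-zeroʳ (δ (asymmetries x) h′))) (ℕP.*-zeroʳ (δ (size x) h))) ts))

forkWeight : Tree × Tree → ℕSeries
forkWeight (l , r) = monoᴺ (size l + size r) (𝟙 (l ≁? r) + (asymmetries l + asymmetries r)) (ones l + ones r)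

weight-node : ∀ col p n ℓ c → weight (uncurry (node col) p) n ℓ c ≡ (monoᴺ 1 0 (colorVal col) ⊗ᴺ forkWeight p) n ℓ c
weight-node col (l , r) n ℓ c =
  sym (monoᴺ-⊗ᴺ-monoᴺ 1 0 (colorVal col) (size l + size r) (𝟙 (l ≁? r) + (asymmetries l + asymmetries r)) (ones l + ones r) n ℓ c)

forkWeight-diagonal : ∀ x n ℓ c → forkWeight (x , x) n ℓ c ≡ jointWeight (x , x) n ℓ c
forkWeight-diagonal x n ℓ c =
  cong (λ b → monoᴺ (size x + size x) (b + (asymmetries x + asymmetries x)) (ones x + ones x) n ℓ c)
       (𝟙-no (x ≁? x) (λ x≁x → x≁x (∼-refl x)))

forkWeight-apart : ∀ {x y} → ¬ x ∼ y → ∀ n ℓ c → forkWeight (x , y) n ℓ c ≡ (monoᴺ 0 1 0 ⊗ᴺ jointWeight (x , y)) n ℓ c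
forkWeight-apart {x} {y} x≁y n ℓ c = begin
  forkWeight (x , y) n ℓ c
    ≡⟨ cong (λ b → monoᴺ (size x + size y) (b + (asymmetries x + asymmetries y)) (ones x + ones y) n ℓ c)
            (𝟙-yes (x ≁? y) x≁y) ⟩
  monoᴺ (size x + size y) (1 + (asymmetries x + asymmetries y)) (ones x + ones y) n ℓ c
    ≡⟨ monoᴺ-⊗ᴺ-monoᴺ 0 1 0 (size x + size y) (asymmetries x + asymmetries y) (ones x + ones y) n ℓ c ⟨
  (monoᴺ 0 1 0 ⊗ᴺ jointWeight (x , y)) n ℓ c ∎

-- Representatives of the classes

pairSize : Tree × Tree → ℕ
pairSize p = size (proj₁ p) + size (proj₂ p)

pairSize-cong : ∀ {p q} → p ≈ₚ q → pairSize p ≡ pairSize q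
pairSize-cong (inj₁ (l∼l′ , r∼r′)) = cong₂ _+_ (size-cong l∼l′) (size-cong r∼r′)
pairSize-cong {q = l′ , r′} (inj₂ (l∼r′ , r∼l′)) =
  trans (cong₂ _+_ (size-cong l∼r′) (size-cong r∼l′)) (ℕP.+-comm (size r′) (size l′))

pairsOfSize : ℕ → List Tree → List (Tree × Tree)
pairsOfSize m ts = filter (λ p → pairSize p ≟ m) (pairs ts)

newClasses : ℕ → List Tree → List Tree
newClasses m ts = map (uncurry (node false)) (pairsOfSize m ts) ++ map (uncurry (node true)) (pairsOfSize m ts)

classes : ℕ → List Tree
classes zero    = empty ∷ []
classes (suc m) = classes m ++ newClasses m (classes m)

record Representatives (m : ℕ) (ts : List Tree) : Set where
  field
    bounded  : All (λ t → size t ≤ m) ts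
    distinct : Distinct ts
    complete : ∀ t → size t ≤ m → Any (t ∼_) ts

newClasses-size : ∀ m ts → All (λ t → size t ≡ suc m) (newClasses m ts)
newClasses-size m ts = AllP.++⁺ (AllP.map⁺ sized) (AllP.map⁺ sized)
  where
  sized : All (λ p → suc (pairSize p) ≡ suc m) (pairsOfSize m ts)
  sized = All.map (cong suc) (AllP.all-filter (λ p → pairSize p ≟ m) (pairs ts))

newClasses-distinct : ∀ m {ts} → Distinct ts → Distinct (newClasses m ts)
newClasses-distinct m {ts} distinct = APP.++⁺ (coloured false) (coloured true)
  (AllP.map⁺ (All.universal (λ _ → AllP.map⁺ (All.universal (λ _ → (λ ()) ∘ proj₁) _)) _))
  where
  coloured : ∀ col → Distinct (map (uncurry (node col)) (pairsOfSize m ts))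
  coloured col = APP.map⁺ (AllPairs.map (λ p≉q → p≉q ∘ proj₂)
                   (APP.filter⁺ (λ p → pairSize p ≟ m) (pairs-distinct distinct)))

pairsOfSize-complete : ∀ {m ts} → (∀ t → size t ≤ m → Any (t ∼_) ts) →
                       ∀ {l r} → size l + size r ≡ m → Any ((l , r) ≈ₚ_) (pairsOfSize m ts)
pairsOfSize-complete {m} complete {l} {r} l+r≡m = Any-filter⁺ (λ p → pairSize p ≟ m)
  (Any.map (λ l,r≈ₚp → l,r≈ₚp , trans (sym (pairSize-cong l,r≈ₚp)) l+r≡m)
    (pairs-complete (complete l (subst (size l ≤_) l+r≡m (ℕP.m≤m+n (size l) (size r))))
                    (complete r (subst (size r ≤_) l+r≡m (ℕP.m≤n+m (size r) (size l))))))

newClasses-complete : ∀ {m ts} → (∀ t → size t ≤ m → Any (t ∼_) ts) →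
                      ∀ col l r → size l + size r ≡ m → Any (node col l r ∼_) (newClasses m ts)
newClasses-complete complete false l r l+r≡m =
  AnyP.++⁺ˡ (AnyP.map⁺ (Any.map (refl ,_) (pairsOfSize-complete complete l+r≡m)))
newClasses-complete {m} {ts} complete true l r l+r≡m =
  AnyP.++⁺ʳ (map (uncurry (node false)) (pairsOfSize m ts)) (AnyP.map⁺ (Any.map (refl ,_) (pairsOfSize-complete complete l+r≡m)))

classes-representatives : ∀ m → Representatives m (classes m)
classes-representatives zero = record
  { bounded  = z≤n ∷ []
  ; distinct = [] ∷ []
  ; complete = λ { empty _ → here tt ; (node _ _ _) () }
  }
classes-representatives (suc m) = record
  { bounded  = AllP.++⁺ (All.map ℕP.m≤n⇒m≤1+n bounded) (All.map ℕP.≤-reflexive (newClasses-size m (classes m)))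
  ; distinct = APP.++⁺ distinct (newClasses-distinct m distinct)
                 (All.map (λ s≤m → All.map (old≁new s≤m) (newClasses-size m (classes m))) bounded)
  ; complete = complete⁺
  }
  where
  open Representatives (classes-representatives m)

  old≁new : ∀ {s t} → size s ≤ m → size t ≡ suc m → ¬ s ∼ t
  old≁new s≤m t≡1+m s∼t = ℕP.n≮n m (subst (_≤ m) (trans (size-cong s∼t) t≡1+m) s≤m)

  complete⁺ : ∀ t → size t ≤ suc m → Any (t ∼_) (classes (suc m))
  complete⁺ t t≤1+m with ℕP.m≤n⇒m<n∨m≡n t≤1+m
  ... | inj₁ t<1+m = AnyP.++⁺ˡ (complete t (ℕP.≤-pred t<1+m))
  complete⁺ (node col l r) _ | inj₂ t≡1+m =
    AnyP.++⁺ʳ (classes m) (newClasses-complete complete col l r (ℕP.suc-injective t≡1+m))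

-- Counting the classes

HasStats : ℕ → ℕ → ℕ → Tree → Set
HasStats n ℓ c t = size t ≡ n × asymmetries t ≡ ℓ × ones t ≡ c

hasStats? : ∀ n ℓ c → Decidable (HasStats n ℓ c)
hasStats? n ℓ c t = (size t ≟ n) ×-dec ((asymmetries t ≟ ℓ) ×-dec (ones t ≟ c))

representatives : ℕ → ℕ → ℕ → List Tree
representatives n ℓ c = filter (hasStats? n ℓ c) (classes n)

K : ℕ → ℕ → ℕ → ℕ
K n ℓ c = length (representatives n ℓ c)

numClasses : ∀ n ℓ c → NumClasses n ℓ c (K n ℓ c)
numClasses n ℓ c =
  representatives n ℓ c , refl ,
  All.map HasStats⇒Stats (AllP.all-filter (hasStats? n ℓ c) (classes n)) ,
  APP.filter⁺ (hasStats? n ℓ c) distinct ,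
  λ t st → Any-filter⁺ (hasStats? n ℓ c) (Any.map (λ t∼r → t∼r , transport t∼r (Stats⇒≡ st)) (listed t st))
  where
  open Representatives (classes-representatives n)
  HasStats⇒Stats : ∀ {t} → HasStats n ℓ c t → Stats t n ℓ c
  HasStats⇒Stats {t} (refl , refl , refl) = stats t
  transport : ∀ {t r} → t ∼ r → HasStats n ℓ c t → HasStats n ℓ c r
  transport t∼r (refl , refl , refl) = sym (size-cong t∼r) , sym (asymmetries-cong t∼r) , sym (ones-cong t∼r)
  listed : ∀ t → Stats t n ℓ c → Any (t ∼_) (classes n)
  listed t st = complete t (ℕP.≤-reflexive (proj₁ (Stats⇒≡ st)))

treeSeries-classes-suc : ∀ {n N} ℓ c → n ≤ N → treeSeries (classes (suc N)) n ℓ c ≡ treeSeries (classes N) n ℓ c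
treeSeries-classes-suc {n} {N} ℓ c n≤N = begin
  treeSeries (classes N ++ newClasses N (classes N)) n ℓ c
    ≡⟨ ∑-++ (classes N) _ _ ⟩
  treeSeries (classes N) n ℓ c + ∑[ t ∈ newClasses N (classes N) ] weight t n ℓ c
    ≡⟨ cong (treeSeries (classes N) n ℓ c +_) (∑-zero (All.map too-big (newClasses-size N (classes N)))) ⟩
  treeSeries (classes N) n ℓ c + 0
    ≡⟨ ℕP.+-identityʳ _ ⟩
  treeSeries (classes N) n ℓ c ∎
  where
  too-big : ∀ {t} → size t ≡ suc N → weight t n ℓ c ≡ 0
  too-big {t} t≡1+N = weight-vanishes t ℓ c (λ t≡n → ℕP.n≮n N (subst (_≤ N) (trans (sym t≡n) t≡1+N) n≤N))

treeSeries-classes-stable : ∀ {n} k ℓ c → treeSeries (classes (k + n)) n ℓ c ≡ treeSeries (classes n) n ℓ c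
treeSeries-classes-stable         zero    ℓ c = refl
treeSeries-classes-stable {n} (suc k) ℓ c =
  trans (treeSeries-classes-suc ℓ c (ℕP.m≤n+m n k)) (treeSeries-classes-stable k ℓ c)

K≡treeSeries : ∀ {n N} ℓ c → n ≤ N → K n ℓ c ≡ treeSeries (classes N) n ℓ c
K≡treeSeries {n} {N} ℓ c n≤N = begin
  K n ℓ c
    ≡⟨ length-filter (hasStats? n ℓ c) (classes n) ⟩
  ∑[ t ∈ classes n ] 𝟙 (hasStats? n ℓ c t)
    ≡⟨ ∑-cong (classes n) (λ t → monoᴺ-𝟙 (size t) (asymmetries t) (ones t) n ℓ c) ⟨
  treeSeries (classes n) n ℓ c
    ≡⟨ treeSeries-classes-stable (N ∸ n) ℓ c ⟨
  treeSeries (classes (N ∸ n + n)) n ℓ c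
    ≡⟨ cong (λ M → treeSeries (classes M) n ℓ c) (ℕP.m∸n+n≡m n≤N) ⟩
  treeSeries (classes N) n ℓ c ∎

forks : ℕSeries
forks n ℓ c = ∑[ p ∈ pairs (classes n) ] forkWeight p n ℓ c

newClasses-coloured : ∀ col m ℓ c →
  ∑[ p ∈ pairsOfSize m (classes m) ] weight (uncurry (node col) p) (suc m) ℓ c ≡ (monoᴺ 1 0 (colorVal col) ⊗ᴺ forks) (suc m) ℓ c
newClasses-coloured col m ℓ c = begin
  ∑[ p ∈ pairsOfSize m (classes m) ] weight (uncurry (node col) p) (suc m) ℓ c
    ≡⟨ ∑-filter (λ p → pairSize p ≟ m) (pairs (classes m)) (λ p → weight (uncurry (node col) p) (suc m) ℓ c)
                (λ p p≢m → weight-vanishes (uncurry (node col) p) ℓ c (p≢m ∘ ℕP.suc-injective)) ⟩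
  ∑[ p ∈ pairs (classes m) ] weight (uncurry (node col) p) (suc m) ℓ c
    ≡⟨ ∑-cong (pairs (classes m)) (λ p → weight-node col p (suc m) ℓ c) ⟩
  ∑[ p ∈ pairs (classes m) ] (monoᴺ 1 0 (colorVal col) ⊗ᴺ forkWeight p) (suc m) ℓ c
    ≡⟨ ⊗ᴺ-∑ (pairs (classes m)) (monoᴺ 1 0 (colorVal col)) forkWeight (suc m) ℓ c ⟨
  (monoᴺ 1 0 (colorVal col) ⊗ᴺ (λ i j k → ∑[ p ∈ pairs (classes m) ] forkWeight p i j k)) (suc m) ℓ c
    ≡⟨ monoᴺ-⊗ᴺ-cong 1 0 (colorVal col) (λ i j k → ∑[ p ∈ pairs (classes m) ] forkWeight p i j k) forks (suc m) ℓ c refl ⟩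
  (monoᴺ 1 0 (colorVal col) ⊗ᴺ forks) (suc m) ℓ c ∎

K-recurrence : ∀ n ℓ c → K n ℓ c ≡ monoᴺ 0 0 0 n ℓ c + (monoᴺ 1 0 0 ⊗ᴺ forks) n ℓ c + (monoᴺ 1 0 1 ⊗ᴺ forks) n ℓ c
K-recurrence zero ℓ c = begin
  K 0 ℓ c                  ≡⟨ K≡treeSeries {0} {0} ℓ c z≤n ⟩
  monoᴺ 0 0 0 0 ℓ c + 0     ≡⟨ ℕP.+-identityʳ _ ⟨
  monoᴺ 0 0 0 0 ℓ c + 0 + 0 ≡⟨ cong₂ (λ x y → monoᴺ 0 0 0 0 ℓ c + x + y) (no-root 0) (no-root 1) ⟨
  monoᴺ 0 0 0 0 ℓ c + (monoᴺ 1 0 0 ⊗ᴺ forks) 0 ℓ c + (monoᴺ 1 0 1 ⊗ᴺ forks) 0 ℓ c ∎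
  where
  no-root : ∀ d → (monoᴺ 1 0 d ⊗ᴺ forks) 0 ℓ c ≡ 0
  no-root d = monoᴺ-⊗ᴺ-out 1 0 d forks 0 ℓ c (inj₁ (s≤s z≤n))
K-recurrence (suc m) ℓ c = begin
  K (suc m) ℓ c
    ≡⟨ K≡treeSeries {suc m} ℓ c ℕP.≤-refl ⟩
  treeSeries (classes m ++ newClasses m (classes m)) (suc m) ℓ c
    ≡⟨ ∑-++ (classes m) (newClasses m (classes m)) at ⟩
  treeSeries (classes m) (suc m) ℓ c + ∑[ t ∈ newClasses m (classes m) ] weight t (suc m) ℓ c
    ≡⟨ cong₂ _+_ (∑-zero (All.map (λ {t} t≤m → weight-vanishes t ℓ c (λ t≡1+m → ℕP.n≮n m (subst (_≤ m) t≡1+m t≤m)))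
                                  bounded))
                 (∑-++ (map (uncurry (node false)) (pairsOfSize m (classes m))) (map (uncurry (node true)) (pairsOfSize m (classes m))) at) ⟩
  ∑[ t ∈ map (uncurry (node false)) (pairsOfSize m (classes m)) ] weight t (suc m) ℓ c
    + ∑[ t ∈ map (uncurry (node true)) (pairsOfSize m (classes m)) ] weight t (suc m) ℓ c
    ≡⟨ cong₂ _+_ (trans (∑-map (uncurry (node false)) (pairsOfSize m (classes m)) at) (newClasses-coloured false m ℓ c))
                 (trans (∑-map (uncurry (node true)) (pairsOfSize m (classes m)) at) (newClasses-coloured true m ℓ c)) ⟩
  (monoᴺ 1 0 0 ⊗ᴺ forks) (suc m) ℓ c + (monoᴺ 1 0 1 ⊗ᴺ forks) (suc m) ℓ c ∎
  where
  open Representatives (classes-representatives m)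
  at : Tree → ℕ
  at t = weight t (suc m) ℓ c

equalPairs distinctPairs : ℕSeries
equalPairs    n ℓ c = ∑[ x ∈ classes n ] jointWeight (x , x) n ℓ c
distinctPairs n ℓ c = ∑[ p ∈ offDiagonal (classes n) ] jointWeight p n ℓ c

K-square : ∀ n ℓ c → (K ⊗ᴺ K) n ℓ c ≡ equalPairs n ℓ c + 2 * distinctPairs n ℓ c
K-square n ℓ c = trans
  (⊗ᴺ-cong≤ n ℓ c (λ i j k i≤n → K≡treeSeries j k i≤n) (λ i j k i≤n → K≡treeSeries j k i≤n))
  (treeSeries-square (classes n) n ℓ c)

forks-decomposition : ∀ n ℓ c → forks n ℓ c ≡ equalPairs n ℓ c + (monoᴺ 0 1 0 ⊗ᴺ distinctPairs) n ℓ c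
forks-decomposition n ℓ c = begin
  forks n ℓ c
    ≡⟨ ∑-pairs (classes n) (λ p → forkWeight p n ℓ c) ⟩
  ∑[ x ∈ classes n ] forkWeight (x , x) n ℓ c + ∑[ p ∈ offDiagonal (classes n) ] forkWeight p n ℓ c
    ≡⟨ cong₂ _+_ (∑-cong (classes n) (λ x → forkWeight-diagonal x n ℓ c))
                 (∑-cong-All (All.map (λ x≁y → forkWeight-apart x≁y n ℓ c) (offDiagonal⁺ distinct))) ⟩
  equalPairs n ℓ c + ∑[ p ∈ offDiagonal (classes n) ] (monoᴺ 0 1 0 ⊗ᴺ jointWeight p) n ℓ c
    ≡⟨ cong (equalPairs n ℓ c +_) (⊗ᴺ-∑ (offDiagonal (classes n)) (monoᴺ 0 1 0) jointWeight n ℓ c) ⟨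
  equalPairs n ℓ c + (monoᴺ 0 1 0 ⊗ᴺ (λ i j k → ∑[ p ∈ offDiagonal (classes n) ] jointWeight p i j k)) n ℓ c
    ≡⟨ cong (equalPairs n ℓ c +_)
            (monoᴺ-⊗ᴺ-cong 0 1 0 (λ i j k → ∑[ p ∈ offDiagonal (classes n) ] jointWeight p i j k) distinctPairs n ℓ c refl) ⟩
  equalPairs n ℓ c + (monoᴺ 0 1 0 ⊗ᴺ distinctPairs) n ℓ c ∎
  where open Representatives (classes-representatives n)

squareVarsᴺ-K : ∀ n ℓ c → squareVarsᴺ K n ℓ c ≡ equalPairs n ℓ c
squareVarsᴺ-K n ℓ c =
  trans (squareVarsᴺ-cong≤ n ℓ c (λ i j k i≤n → K≡treeSeries j k i≤n)) (squareVarsᴺ-treeSeries (classes n) n ℓ c)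

-- Rational power series

-- genSeries f n ℓ c is definitionally ι (f n ℓ c).
ι : ℕ → ℚ
ι n = ℤ.+ n / 1

ι-mkℚ : ∀ n → ι n ≡ mkℚ (ℤ.+ n) 0 (Coprime.sym (Coprime.1-coprimeTo n))
ι-mkℚ n = ℚP.↥p/↧p≡p (mkℚ (ℤ.+ n) 0 (Coprime.sym (Coprime.1-coprimeTo n)))

ι-+ : ∀ a b → ι (a + b) ≡ ι a Q.+ ι b
ι-+ a b = trans (ℚP./-cong {q₁ = 1} {q₂ = 1}
                           (cong₂ ℤ._+_ (sym (ℤP.*-identityʳ (ℤ.+ a))) (sym (ℤP.*-identityʳ (ℤ.+ b)))) refl)
                (sym (cong₂ Q._+_ (ι-mkℚ a) (ι-mkℚ b)))

ι-* : ∀ a b → ι (a * b) ≡ ι a Q.* ι b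
ι-* a b = trans (ℚP./-cong {q₁ = 1} {q₂ = 1} (ℤP.pos-* a b) refl) (sym (cong₂ Q._*_ (ι-mkℚ a) (ι-mkℚ b)))

½*ι-double : ∀ a → ½ Q.* ι (2 * a) ≡ ι a
½*ι-double a = begin
  ½ Q.* ι (2 * a)         ≡⟨ cong (½ Q.*_) (trans (cong (λ z → ι (a + z)) (ℕP.+-identityʳ a)) (ι-+ a a)) ⟩
  ½ Q.* (ι a Q.+ ι a)     ≡⟨ ℚP.*-distribˡ-+ ½ (ι a) (ι a) ⟩
  ½ Q.* ι a Q.+ ½ Q.* ι a ≡⟨ ℚP.*-distribʳ-+ (ι a) ½ ½ ⟨
  (½ Q.+ ½) Q.* ι a       ≡⟨ ℚP.*-identityˡ (ι a) ⟩
  ι a                     ∎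

sumTo-cong : ∀ n {f g : ℕ → ℚ} → (∀ i → f i ≡ g i) → sumTo f n ≡ sumTo g n
sumTo-cong zero    f≗g = f≗g zero
sumTo-cong (suc n) f≗g = cong₂ Q._+_ (sumTo-cong n f≗g) (f≗g (suc n))

sumTo-ι : ∀ n (f : ℕ → ℕ) → sumTo (λ i → ι (f i)) n ≡ ι (∑≤ n f)
sumTo-ι zero    f = refl
sumTo-ι (suc n) f = trans (cong (Q._+ ι (f (suc n))) (sumTo-ι n f)) (sym (ι-+ (∑≤ n f) (f (suc n))))

sumTo-linear : ∀ n (p q : ℚ) (f g : ℕ → ℚ) →
               sumTo (λ i → p Q.* f i Q.+ q Q.* g i) n ≡ p Q.* sumTo f n Q.+ q Q.* sumTo g n
sumTo-linear zero    p q f g = refl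
sumTo-linear (suc n) p q f g = trans (cong (Q._+ (p Q.* f (suc n) Q.+ q Q.* g (suc n))) (sumTo-linear n p q f g))
  (solve 6 (λ p q a b c d → (p :* a :+ q :* b) :+ (p :* c :+ q :* d) := p :* (a :+ c) :+ q :* (b :+ d))
         refl p q (sumTo f n) (sumTo g n) (f (suc n)) (g (suc n)))

infix 4 _≐_

_≐_ : PS → PS → Set
f ≐ g = ∀ n ℓ c → f n ℓ c ≡ g n ℓ c

genSeries-⊗ᴺ : ∀ f g → genSeries (f ⊗ᴺ g) ≐ genSeries f ⊗ genSeries g
genSeries-⊗ᴺ f g n ℓ c = sym (begin
  sumTo (λ i → sumTo (λ j → sumTo (λ k → ι (f i j k) Q.* ι (g (n ∸ i) (ℓ ∸ j) (c ∸ k))) c) ℓ) n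
    ≡⟨ sumTo-cong n (λ i → sumTo-cong ℓ (λ j → sumTo-cong c (λ k → sym (ι-* (f i j k) (g (n ∸ i) (ℓ ∸ j) (c ∸ k)))))) ⟩
  sumTo (λ i → sumTo (λ j → sumTo (λ k → ι (f i j k * g (n ∸ i) (ℓ ∸ j) (c ∸ k))) c) ℓ) n
    ≡⟨ sumTo-cong n (λ i → trans (sumTo-cong ℓ (λ j → sumTo-ι c _)) (sumTo-ι ℓ _)) ⟩
  sumTo (λ i → ι (∑[ j ≤ ℓ ] ∑[ k ≤ c ] (f i j k * g (n ∸ i) (ℓ ∸ j) (c ∸ k)))) n
    ≡⟨ sumTo-ι n _ ⟩
  genSeries (f ⊗ᴺ g) n ℓ c ∎)

⊗-cong : ∀ {f f′ g g′} → f ≐ f′ → g ≐ g′ → f ⊗ g ≐ f′ ⊗ g′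
⊗-cong f≐f′ g≐g′ n ℓ c = sumTo-cong n (λ i → sumTo-cong ℓ (λ j → sumTo-cong c (λ k →
  cong₂ Q._*_ (f≐f′ i j k) (g≐g′ (n ∸ i) (ℓ ∸ j) (c ∸ k)))))

⊗-linearˡ : ∀ p q f g h → (λ i j k → p Q.* f i j k Q.+ q Q.* g i j k) ⊗ h
                         ≐ λ n ℓ c → p Q.* (f ⊗ h) n ℓ c Q.+ q Q.* (g ⊗ h) n ℓ c
⊗-linearˡ p q f g h n ℓ c = begin
  sumTo (λ i → sumTo (λ j → sumTo (λ k → (p Q.* f i j k Q.+ q Q.* g i j k) Q.* H i j k) c) ℓ) n
    ≡⟨ sumTo-cong n (λ i → sumTo-cong ℓ (λ j → sumTo-cong c (λ k → distrib p q (f i j k) (g i j k) (H i j k)))) ⟩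
  sumTo (λ i → sumTo (λ j → sumTo (λ k → p Q.* (f i j k Q.* H i j k) Q.+ q Q.* (g i j k Q.* H i j k)) c) ℓ) n
    ≡⟨ sumTo-cong n (λ i → trans (sumTo-cong ℓ (λ j → sumTo-linear c p q _ _)) (sumTo-linear ℓ p q _ _)) ⟩
  sumTo (λ i → p Q.* F i Q.+ q Q.* G i) n
    ≡⟨ sumTo-linear n p q F G ⟩
  p Q.* (f ⊗ h) n ℓ c Q.+ q Q.* (g ⊗ h) n ℓ c ∎
  where
  H : ℕ → ℕ → ℕ → ℚ
  H i j k = h (n ∸ i) (ℓ ∸ j) (c ∸ k)
  F G : ℕ → ℚ
  F i = sumTo (λ j → sumTo (λ k → f i j k Q.* H i j k) c) ℓ
  G i = sumTo (λ j → sumTo (λ k → g i j k Q.* H i j k) c) ℓ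
  distrib : ∀ p q x y z → (p Q.* x Q.+ q Q.* y) Q.* z ≡ p Q.* (x Q.* z) Q.+ q Q.* (y Q.* z)
  distrib = solve 5 (λ p q x y z → (p :* x :+ q :* y) :* z := p :* (x :* z) :+ q :* (y :* z)) refl

mono≐genSeries : ∀ a b d → mono a b d ≐ genSeries (monoᴺ a b d)
mono≐genSeries a b d n ℓ c = trans mono≡ι𝟙 (cong ι (sym (monoᴺ-𝟙 a b d n ℓ c)))
  where
  mono≡ι𝟙 : mono a b d n ℓ c ≡ ι (𝟙 (same? a b d n ℓ c))
  mono≡ι𝟙 with a ≟ n | b ≟ ℓ | d ≟ c
  ... | yes a≡n | yes b≡ℓ | yes d≡c = cong ι (sym (𝟙-yes (same? a b d n ℓ c) (a≡n , b≡ℓ , d≡c)))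
  ... | no a≢n  | _       | _       = cong ι (sym (𝟙-no (same? a b d n ℓ c) (a≢n ∘ proj₁)))
  ... | yes _   | no b≢ℓ  | _       = cong ι (sym (𝟙-no (same? a b d n ℓ c) (b≢ℓ ∘ proj₁ ∘ proj₂)))
  ... | yes _   | yes _   | no d≢c  = cong ι (sym (𝟙-no (same? a b d n ℓ c) (d≢c ∘ proj₂ ∘ proj₂)))

squareVars-genSeries : ∀ f → squareVars (genSeries f) ≐ genSeries (squareVarsᴺ f)
squareVars-genSeries f n ℓ c with halve n | halve ℓ | halve c
... | just _  | just _  | just _  = refl
... | nothing | _       | _       = refl
... | just _  | nothing | _       = refl
... | just _  | just _  | nothing = refl

mono-⊗-genSeries : ∀ a b d f → mono a b d ⊗ genSeries f ≐ genSeries (monoᴺ a b d ⊗ᴺ f)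
mono-⊗-genSeries a b d f n ℓ c =
  trans (⊗-cong {g = genSeries f} {g′ = genSeries f} (mono≐genSeries a b d) (λ _ _ _ → refl) n ℓ c)
        (sym (genSeries-⊗ᴺ (monoᴺ a b d) f n ℓ c))

mono-⊗-squareVars-K : ∀ a b d n ℓ c → (mono a b d ⊗ squareVars (genSeries K)) n ℓ c ≡ ι ((monoᴺ a b d ⊗ᴺ equalPairs) n ℓ c)
mono-⊗-squareVars-K a b d n ℓ c = begin
  (mono a b d ⊗ squareVars (genSeries K)) n ℓ c
    ≡⟨ ⊗-cong {f = mono a b d} (λ _ _ _ → refl) (squareVars-genSeries K) n ℓ c ⟩
  (mono a b d ⊗ genSeries (squareVarsᴺ K)) n ℓ c
    ≡⟨ mono-⊗-genSeries a b d (squareVarsᴺ K) n ℓ c ⟩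
  ι ((monoᴺ a b d ⊗ᴺ squareVarsᴺ K) n ℓ c)
    ≡⟨ cong ι (monoᴺ-⊗ᴺ-cong a b d (squareVarsᴺ K) equalPairs n ℓ c (squareVarsᴺ-K (n ∸ a) (ℓ ∸ b) (c ∸ d))) ⟩
  ι ((monoᴺ a b d ⊗ᴺ equalPairs) n ℓ c) ∎

mono-⊗-square-K : ∀ a b d n ℓ c → (mono a b d ⊗ (genSeries K ⊗ genSeries K)) n ℓ c
                ≡ ι ((monoᴺ a b d ⊗ᴺ equalPairs) n ℓ c + 2 * (monoᴺ a b d ⊗ᴺ distinctPairs) n ℓ c)
mono-⊗-square-K a b d n ℓ c = begin
  (mono a b d ⊗ (genSeries K ⊗ genSeries K)) n ℓ c
    ≡⟨ ⊗-cong {f = mono a b d} (λ _ _ _ → refl) (λ i j k → sym (genSeries-⊗ᴺ K K i j k)) n ℓ c ⟩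
  (mono a b d ⊗ genSeries (K ⊗ᴺ K)) n ℓ c
    ≡⟨ mono-⊗-genSeries a b d (K ⊗ᴺ K) n ℓ c ⟩
  ι ((monoᴺ a b d ⊗ᴺ (K ⊗ᴺ K)) n ℓ c)
    ≡⟨ cong ι (monoᴺ-⊗ᴺ-cong a b d (K ⊗ᴺ K) (λ i j k → equalPairs i j k + 2 * distinctPairs i j k) n ℓ c
                              (K-square (n ∸ a) (ℓ ∸ b) (c ∸ d))) ⟩
  ι ((monoᴺ a b d ⊗ᴺ (λ i j k → equalPairs i j k + 2 * distinctPairs i j k)) n ℓ c)
    ≡⟨ cong ι (trans (monoᴺ-⊗ᴺ-+ a b d equalPairs (λ i j k → 2 * distinctPairs i j k) n ℓ c)
                     (cong ((monoᴺ a b d ⊗ᴺ equalPairs) n ℓ c +_) (monoᴺ-⊗ᴺ-* a b d 2 distinctPairs n ℓ c))) ⟩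
  ι ((monoᴺ a b d ⊗ᴺ equalPairs) n ℓ c + 2 * (monoᴺ a b d ⊗ᴺ distinctPairs) n ℓ c) ∎

-- The functional equation

-- Imported only here: its prefix +_ makes the sections (x +_) above ambiguous.
open import Data.Integer using (+_)

bracket : PS
bracket = ((+ 2 / 1) ⊙ one ⊖ Y) ⊗ squareVars (genSeries K) ⊕ Y ⊗ (genSeries K ⊗ genSeries K)

bracket-coefficient : bracket ≐ genSeries (λ n ℓ c → 2 * forks n ℓ c)
bracket-coefficient n ℓ c = begin
  (((+ 2 / 1) ⊙ one ⊖ Y) ⊗ squareVars (genSeries K)) n ℓ c Q.+ (Y ⊗ (genSeries K ⊗ genSeries K)) n ℓ c
    ≡⟨ cong (Q._+ (Y ⊗ (genSeries K ⊗ genSeries K)) n ℓ c)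
            (trans (⊗-cong {g = squareVars (genSeries K)} as-combination (λ _ _ _ → refl) n ℓ c)
                   (⊗-linearˡ (ι 2) (Q.- Q.1ℚ) one Y (squareVars (genSeries K)) n ℓ c)) ⟩
  ι 2 Q.* (one ⊗ squareVars (genSeries K)) n ℓ c Q.+ (Q.- Q.1ℚ) Q.* (Y ⊗ squareVars (genSeries K)) n ℓ c
    Q.+ (Y ⊗ (genSeries K ⊗ genSeries K)) n ℓ c
    ≡⟨ cong₂ Q._+_ (cong₂ (λ s t → ι 2 Q.* s Q.+ (Q.- Q.1ℚ) Q.* t)
                          (trans (mono-⊗-squareVars-K 0 0 0 n ℓ c) (cong ι (monoᴺ-⊗ᴺ-in 0 0 0 equalPairs n ℓ c z≤n z≤n z≤n)))
                          (mono-⊗-squareVars-K 0 1 0 n ℓ c))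
                   (trans (mono-⊗-square-K 0 1 0 n ℓ c) (trans (ι-+ YE (2 * YU)) (cong (ι YE Q.+_) (ι-* 2 YU)))) ⟩
  ι 2 Q.* ι (equalPairs n ℓ c) Q.+ (Q.- Q.1ℚ) Q.* ι YE Q.+ (ι YE Q.+ ι 2 Q.* ι YU)
    ≡⟨ solve 4 (λ t e a b → t :* e :+ con (Q.- Q.1ℚ) :* a :+ (a :+ t :* b) := t :* (e :+ b))
               refl (ι 2) (ι (equalPairs n ℓ c)) (ι YE) (ι YU) ⟩
  ι 2 Q.* (ι (equalPairs n ℓ c) Q.+ ι YU)
    ≡⟨ trans (cong (ι 2 Q.*_) (sym (ι-+ (equalPairs n ℓ c) YU))) (sym (ι-* 2 (equalPairs n ℓ c + YU))) ⟩
  ι (2 * (equalPairs n ℓ c + YU))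
    ≡⟨ cong (λ m → ι (2 * m)) (forks-decomposition n ℓ c) ⟨
  ι (2 * forks n ℓ c) ∎
  where
  YE = (monoᴺ 0 1 0 ⊗ᴺ equalPairs) n ℓ c
  YU = (monoᴺ 0 1 0 ⊗ᴺ distinctPairs) n ℓ c
  as-combination : (+ 2 / 1) ⊙ one ⊖ Y ≐ λ i j k → ι 2 Q.* one i j k Q.+ (Q.- Q.1ℚ) Q.* Y i j k
  as-combination i j k = solve 2 (λ x y → con (ι 2) :* x :- y := con (ι 2) :* x :+ con (Q.- Q.1ℚ) :* y) refl (one i j k) (Y i j k)

X⊗[one⊕Z] : X ⊗ (one ⊕ Z) ≐ λ i j k → genSeries (monoᴺ 1 0 0) i j k Q.+ genSeries (monoᴺ 1 0 1) i j k
X⊗[one⊕Z] n ℓ c = begin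
  (X ⊗ (one ⊕ Z)) n ℓ c
    ≡⟨ ⊗-cong {f = X} (λ _ _ _ → refl) one⊕Z n ℓ c ⟩
  (X ⊗ genSeries (λ i j k → monoᴺ 0 0 0 i j k + monoᴺ 0 0 1 i j k)) n ℓ c
    ≡⟨ mono-⊗-genSeries 1 0 0 (λ i j k → monoᴺ 0 0 0 i j k + monoᴺ 0 0 1 i j k) n ℓ c ⟩
  ι ((monoᴺ 1 0 0 ⊗ᴺ (λ i j k → monoᴺ 0 0 0 i j k + monoᴺ 0 0 1 i j k)) n ℓ c)
    ≡⟨ cong ι (trans (monoᴺ-⊗ᴺ-+ 1 0 0 (monoᴺ 0 0 0) (monoᴺ 0 0 1) n ℓ c)
                     (cong₂ _+_ (monoᴺ-⊗ᴺ-monoᴺ 1 0 0 0 0 0 n ℓ c) (monoᴺ-⊗ᴺ-monoᴺ 1 0 0 0 0 1 n ℓ c))) ⟩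
  ι (monoᴺ 1 0 0 n ℓ c + monoᴺ 1 0 1 n ℓ c)
    ≡⟨ ι-+ (monoᴺ 1 0 0 n ℓ c) (monoᴺ 1 0 1 n ℓ c) ⟩
  genSeries (monoᴺ 1 0 0) n ℓ c Q.+ genSeries (monoᴺ 1 0 1) n ℓ c ∎
  where
  one⊕Z : one ⊕ Z ≐ genSeries (λ i j k → monoᴺ 0 0 0 i j k + monoᴺ 0 0 1 i j k)
  one⊕Z i j k = trans (cong₂ Q._+_ (mono≐genSeries 0 0 0 i j k) (mono≐genSeries 0 0 1 i j k))
                      (sym (ι-+ (monoᴺ 0 0 0 i j k) (monoᴺ 0 0 1 i j k)))

½*root⊗bracket : ∀ d n ℓ c → ½ Q.* (genSeries (monoᴺ 1 0 d) ⊗ bracket) n ℓ c ≡ ι ((monoᴺ 1 0 d ⊗ᴺ forks) n ℓ c)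
½*root⊗bracket d n ℓ c = begin
  ½ Q.* (genSeries (monoᴺ 1 0 d) ⊗ bracket) n ℓ c
    ≡⟨ cong (½ Q.*_) (⊗-cong {f = genSeries (monoᴺ 1 0 d)} (λ _ _ _ → refl) bracket-coefficient n ℓ c) ⟩
  ½ Q.* (genSeries (monoᴺ 1 0 d) ⊗ genSeries (λ i j k → 2 * forks i j k)) n ℓ c
    ≡⟨ cong (½ Q.*_) (genSeries-⊗ᴺ (monoᴺ 1 0 d) (λ i j k → 2 * forks i j k) n ℓ c) ⟨
  ½ Q.* ι ((monoᴺ 1 0 d ⊗ᴺ (λ i j k → 2 * forks i j k)) n ℓ c)
    ≡⟨ cong (λ m → ½ Q.* ι m) (monoᴺ-⊗ᴺ-* 1 0 d 2 forks n ℓ c) ⟩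
  ½ Q.* ι (2 * (monoᴺ 1 0 d ⊗ᴺ forks) n ℓ c)
    ≡⟨ ½*ι-double ((monoᴺ 1 0 d ⊗ᴺ forks) n ℓ c) ⟩
  ι ((monoᴺ 1 0 d ⊗ᴺ forks) n ℓ c) ∎

generating-equation : genSeries K ≐ one ⊕ ½ ⊙ (X ⊗ (one ⊕ Z)) ⊗ bracket
generating-equation n ℓ c = begin
  ι (K n ℓ c)
    ≡⟨ cong ι (K-recurrence n ℓ c) ⟩
  ι (monoᴺ 0 0 0 n ℓ c + Xf + XZf)
    ≡⟨ trans (ι-+ (monoᴺ 0 0 0 n ℓ c + Xf) XZf)
             (trans (cong (Q._+ ι XZf) (ι-+ (monoᴺ 0 0 0 n ℓ c) Xf)) (ℚP.+-assoc (ι (monoᴺ 0 0 0 n ℓ c)) (ι Xf) (ι XZf))) ⟩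
  ι (monoᴺ 0 0 0 n ℓ c) Q.+ (ι Xf Q.+ ι XZf)
    ≡⟨ cong₂ Q._+_ (mono≐genSeries 0 0 0 n ℓ c) (cong₂ Q._+_ (½*root⊗bracket 0 n ℓ c) (½*root⊗bracket 1 n ℓ c)) ⟨
  one n ℓ c Q.+ (½ Q.* (genSeries (monoᴺ 1 0 0) ⊗ bracket) n ℓ c Q.+ ½ Q.* (genSeries (monoᴺ 1 0 1) ⊗ bracket) n ℓ c)
    ≡⟨ cong (one n ℓ c Q.+_) (⊗-linearˡ ½ ½ (genSeries (monoᴺ 1 0 0)) (genSeries (monoᴺ 1 0 1)) bracket n ℓ c) ⟨
  one n ℓ c Q.+ ((λ i j k → ½ Q.* genSeries (monoᴺ 1 0 0) i j k Q.+ ½ Q.* genSeries (monoᴺ 1 0 1) i j k) ⊗ bracket) n ℓ c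
    ≡⟨ cong (one n ℓ c Q.+_) (⊗-cong {g = bracket} half-W (λ _ _ _ → refl) n ℓ c) ⟨
  one n ℓ c Q.+ (½ ⊙ (X ⊗ (one ⊕ Z)) ⊗ bracket) n ℓ c ∎
  where
  Xf  = (monoᴺ 1 0 0 ⊗ᴺ forks) n ℓ c
  XZf = (monoᴺ 1 0 1 ⊗ᴺ forks) n ℓ c
  half-W : ½ ⊙ (X ⊗ (one ⊕ Z)) ≐ λ i j k → ½ Q.* genSeries (monoᴺ 1 0 0) i j k Q.+ ½ Q.* genSeries (monoᴺ 1 0 1) i j k
  half-W i j k = trans (cong (½ Q.*_) (X⊗[one⊕Z] i j k))
                       (ℚP.*-distribˡ-+ ½ (genSeries (monoᴺ 1 0 0) i j k) (genSeries (monoᴺ 1 0 1) i j k))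

mainTheorem3 : Σ[ K ∈ (ℕ → ℕ → ℕ → ℕ) ]
    ((∀ n ℓ c → NumClasses n ℓ c (K n ℓ c))
    × (∀ n ℓ c → genSeries K n ℓ c ≡ (one ⊕ ½ ⊙ (X ⊗ (one ⊕ Z))
         ⊗ (((+ 2 / 1) ⊙ one ⊖ Y) ⊗ squareVars (genSeries K)
            ⊕ Y ⊗ (genSeries K ⊗ genSeries K))) n ℓ c))
mainTheorem3 = K , numClasses , generating-equation
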